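{- Let $p$ be a prime, $n=p^2$, and let $\Gamma=\Gamma(D_{2n})$ be the intersection graph of $D_{2n}$. Then the second Zagreb index of $\Gamma$ is $M_2(\Gamma)=2p^4+6p^3+\frac{13}{2}p^2+\frac{7}{2}p+1$.
   Context: $D_{2n}=\langle r,s : r^n=s^2=1,\ srs=r^{ -1}\rangle$ is the dihedral group of order $2n$. The intersection graph $\Gamma(G)$ of a finite group $G$ has as vertices the proper non-trivial subgroups of $G$, two distinct vertices being adjacent iff their intersection is non-trivial. The second Zagreb index is $M_2(\Gamma)=\sum_{uv\in E(\Gamma)}\deg(u)\deg(v)$. -}

module Defs where

open import Data.Nat using (ℕ; zero; suc; _+_; _*_; _∸_; _≡ᵇ_; NonZero)
open import Data.Nat.DivMod using (_mod_)
open import Data.Fin using (Fin; toℕ)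
open import Data.Bool using (Bool; true; false; _∧_; _∨_; not; _xor_; if_then_else_)
open import Data.Product using (_×_; _,_)
open import Data.List using (List; []; _∷_; _++_; map; allFin; filterᵇ; length; concatMap; cartesianProduct)
open import Data.Bool.ListAction using (all; any)
open import Data.Nat.ListAction using (sum)
open import Data.Vec using (Vec; lookup) renaming ([] to []ᵥ; _∷_ to _∷ᵥ_)

-- The dihedral group D_{2n} = ⟨ r , s | r^n = s^2 = 1 , srs = r⁻¹ ⟩ (n ≥ 1),
-- concretely: the pair (i , b) stands for the element r^i s^b (i < n, b ∈ {0,1}).
module Dihedral (n : ℕ) .{{_ : NonZero n}} where

  Elt : Set
  Elt = Fin n × Bool

  -- r^i s^a · r^j s^b = r^(i + (-1)^a j) s^(a+b)   (using s r^j = r^(-j) s)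
  _·_ : Elt → Elt → Elt
  (i , a) · (j , b) =
    ((toℕ i + (if a then n ∸ toℕ j else toℕ j)) mod n , a xor b)

  e : Elt
  e = (0 mod n , false)

  inv : Elt → Elt
  inv (i , false) = ((n ∸ toℕ i) mod n , false)
  inv (i , true)  = (i , true)

  isE : Elt → Bool
  isE (i , b) = (toℕ i ≡ᵇ 0) ∧ not b

  elems : List Elt
  elems = map (λ i → (i , false)) (allFin n) ++ map (λ i → (i , true)) (allFin n)

  -- a subset of D_{2n}: characteristic vectors of its rotations r^i and of its reflections r^i s
  Sub : Set
  Sub = Vec Bool n × Vec Bool n

  _∈ᵇ_ : Elt → Sub → Bool
  (i , false) ∈ᵇ (R , S) = lookup R i
  (i , true)  ∈ᵇ (R , S) = lookup S i

  allVecs : ∀ m → List (Vec Bool m)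
  allVecs zero    = []ᵥ ∷ []
  allVecs (suc m) = concatMap (λ v → (true ∷ᵥ v) ∷ (false ∷ᵥ v) ∷ []) (allVecs m)

  allSubs : List Sub
  allSubs = cartesianProduct (allVecs n) (allVecs n)

  isSubgroup : Sub → Bool
  isSubgroup H =
    (e ∈ᵇ H)
    ∧ all (λ x → all (λ y → not (x ∈ᵇ H) ∨ not (y ∈ᵇ H) ∨ ((x · y) ∈ᵇ H)) elems) elems
    ∧ all (λ x → not (x ∈ᵇ H) ∨ (inv x ∈ᵇ H)) elems

  nontrivial : Sub → Bool
  nontrivial H = any (λ x → not (isE x) ∧ (x ∈ᵇ H)) elems

  proper : Sub → Bool
  proper H = any (λ x → not (x ∈ᵇ H)) elems

  sameSub : Sub → Sub → Bool
  sameSub H K = all (λ x → (x ∈ᵇ H) xor (x ∈ᵇ K) xor true) elems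

  vertices : List Sub
  vertices = filterᵇ (λ H → isSubgroup H ∧ nontrivial H ∧ proper H) allSubs

  adj : Sub → Sub → Bool
  adj H K = not (sameSub H K) ∧ any (λ x → not (isE x) ∧ (x ∈ᵇ H) ∧ (x ∈ᵇ K)) elems

  deg : Sub → ℕ
  deg H = length (filterᵇ (adj H) vertices)

  -- sum over unordered edges {u , v} of deg u * deg v (each pair of list positions counted once)
  edgeSum : List Sub → ℕ
  edgeSum []       = 0
  edgeSum (u ∷ vs) = sum (map (λ v → deg u * deg v) (filterᵇ (adj u) vs)) + edgeSum vs

  M₂ : ℕ
  M₂ = edgeSum vertices

-- second Zagreb index of Γ(D_{2n}); D_{2n} needs n ≥ 1 (value at n = 0 is an irrelevant default)
M₂D : ℕ → ℕ
M₂D zero    = 0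
M₂D (suc k) = Dihedral.M₂ (suc k)

-- The proper non-trivial subgroups of D_{2p²} are ⟨r^p⟩, ⟨r⟩, the p² subgroups ⟨r^j s⟩ and the p subgroups
-- ⟨r^p, r^j s⟩ (j < p): the rotations of a subgroup form ⟨r^d⟩ with d ∈ {1, p, p²}, since a rotation r^k with p ∤ k
-- generates ⟨r⟩ and one with p ∣ k ≢ 0 generates ⟨r^p⟩, and its reflections are empty or a coset r^s s ⟨r^d⟩.
-- Two such subgroups meet non-trivially iff both contain r^p, or one is ⟨r^j s⟩ and the other contains r^j s.
-- So the degrees are p + 1, p + 1, 1 and 2p + 1 respectively, and
-- M₂ = (p + 1)² + 2p (p + 1)(2p + 1) + (p choose 2)(2p + 1)² + p² (2p + 1).

module Submission where

open import Defs
open import Data.Nat using (ℕ; _^_)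
open import Data.Nat.Primality using (Prime)
open import Relation.Binary.PropositionalEquality using (_≡_)

open import Data.Bool using (Bool; true; false; _∧_; _∨_; not; _xor_; if_then_else_)
open import Data.Bool.ListAction using (all; any; and; or)
open import Data.Bool.Properties using (T?; T-≡; ∧-comm; ∧-zeroʳ; xor-same; xor-assoc; xor-comm; ⇔→≡)
open import Data.Empty using (⊥; ⊥-elim)
open import Data.Fin using (Fin; toℕ)
open import Data.Fin.Properties using (toℕ-fromℕ<; toℕ-injective; toℕ<n)
open import Data.List using (List; []; _∷_; _++_; map; allFin; filterᵇ; length; concatMap; downFrom; applyDownFrom)
open import Data.List.Membership.Propositional using (_∈_; find; lose)
open import Data.List.Membership.Propositional.Properties
  using (∈-filter⁺; ∈-filter⁻; ∈-++⁺ˡ; ∈-++⁺ʳ; ∈-++⁻; ∈-map⁺; ∈-allFin; ∈-cartesianProduct⁺; ∈-applyDownFrom⁺; ∈-applyDownFrom⁻)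
open import Data.List.Membership.Propositional.Properties.WithK using (unique∧set⇒bag)
open import Data.List.Properties using (map-cong)
open import Data.List.Relation.Binary.BagAndSetEquality using (∼bag⇒↭)
open import Data.List.Relation.Binary.Permutation.Propositional as ↭ using (_↭_)
open import Data.List.Relation.Binary.Permutation.Propositional.Properties using (filter-↭; ↭-length)
open import Data.List.Relation.Unary.All as All using ()
open import Data.List.Relation.Unary.All.Properties using (all⁺; all⁻; applyDownFrom⁺₁) renaming (++⁺ to All-++⁺)
open import Data.List.Relation.Unary.AllPairs using ([]; _∷_)
open import Data.List.Relation.Unary.Any using (here; there)
open import Data.List.Relation.Unary.Any.Properties using (any⁺; any⁻)
open import Data.List.Relation.Unary.Unique.Propositional using (Unique)
import Data.List.Relation.Unary.Unique.Propositional.Properties as Unique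
open import Data.Nat as ℕ hiding (_+_; _*_; _/_)
open import Data.Nat.Coprimality as Coprime using (Coprime; coprime-Bézout; coprime-factors; prime⇒coprime)
open import Data.Nat.Divisibility
open import Data.Nat.DivMod hiding (_/_)
open import Data.Nat.GCD using (module Bézout)
open import Data.Nat.ListAction using (sum)
open import Data.Nat.Primality using (prime⇒nonZero; prime⇒nonTrivial; prime⇒irreducible)
open import Data.Nat.Properties
open import Algebra.Properties.CommutativeSemigroup +-commutativeSemigroup using () renaming (interchange to +-interchange)
open import Data.Nat.Tactic.RingSolver using (solve; solve-∀)
open import Data.Product using (_×_; _,_; proj₁; proj₂; ∃)
open import Data.Sum using (_⊎_; inj₁; inj₂; [_,_]′)
open import Data.Vec using (Vec; lookup; tabulate) renaming ([] to []ᵥ; _∷_ to _∷ᵥ_)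
open import Data.Vec.Properties using (tabulate∘lookup; tabulate-cong; lookup∘tabulate)
open import Function using (_∘_; id)
open import Function.Bundles using (Equivalence; mk⇔)
open import Relation.Binary.PropositionalEquality
open import Relation.Nullary using (¬_; yes; no)
open import Relation.Nullary.Decidable using (dec-true; dec-false)

module _ {A : Set} (f : A → Bool) where

  all≡true⁻ : ∀ xs {x} → all f xs ≡ true → x ∈ xs → f x ≡ true
  all≡true⁻ xs h x∈xs =
    Equivalence.to T-≡ (All.lookup (all⁺ f xs (Equivalence.from T-≡ h)) x∈xs)

  all≡true⁺ : ∀ xs → (∀ {x} → x ∈ xs → f x ≡ true) → all f xs ≡ true
  all≡true⁺ xs h = Equivalence.to T-≡ (all⁻ f (All.tabulate (Equivalence.from T-≡ ∘ h)))

  any≡true⁺ : ∀ {xs x} → x ∈ xs → f x ≡ true → any f xs ≡ true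
  any≡true⁺ x∈xs fx = Equivalence.to T-≡ (any⁺ f (lose x∈xs (Equivalence.from T-≡ fx)))

  any≡true⁻ : ∀ xs → any f xs ≡ true → ∃ λ x → f x ≡ true
  any≡true⁻ xs h =
    let x , _ , fx = find (any⁻ f xs (Equivalence.from T-≡ h)) in x , Equivalence.to T-≡ fx

  any≡false⁺ : ∀ xs → (∀ x → f x ≡ false) → any f xs ≡ false
  any≡false⁺ []       h = refl
  any≡false⁺ (x ∷ xs) h rewrite h x = any≡false⁺ xs h

  ∈-filterᵇ⁺ : ∀ {xs x} → x ∈ xs → f x ≡ true → x ∈ filterᵇ f xs
  ∈-filterᵇ⁺ x∈xs fx = ∈-filter⁺ (T? ∘ f) x∈xs (Equivalence.from T-≡ fx)

  ∈-filterᵇ⁻ : ∀ xs {x} → x ∈ filterᵇ f xs → f x ≡ true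
  ∈-filterᵇ⁻ xs x∈ = Equivalence.to T-≡ (proj₂ (∈-filter⁻ (T? ∘ f) {xs = xs} x∈))

∧-true⁺ : ∀ {a b} → a ≡ true → b ≡ true → a ∧ b ≡ true
∧-true⁺ refl refl = refl

∧-true⁻ : ∀ {a b} → a ∧ b ≡ true → a ≡ true × b ≡ true
∧-true⁻ {true} h = refl , h

⇒-elim₂ : ∀ {a b c} → (not a ∨ not b ∨ c) ≡ true → a ≡ true → b ≡ true → c ≡ true
⇒-elim₂ h refl refl = h

⇒-intro₂ : ∀ {a b c} → (a ≡ true → b ≡ true → c ≡ true) → (not a ∨ not b ∨ c) ≡ true
⇒-intro₂ {false}         f = refl
⇒-intro₂ {true} {false}  f = refl
⇒-intro₂ {true} {true}   f = f refl refl

⇒-intro₁ : ∀ {a c} → (a ≡ true → c ≡ true) → (not a ∨ c) ≡ true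
⇒-intro₁ {false} f = refl
⇒-intro₁ {true}  f = f refl

∧-not≡false⇒ : ∀ {a b} → a ∧ not b ≡ false → b ≡ false → a ≡ false
∧-not≡false⇒ {false} _ _    = refl
∧-not≡false⇒ {true}  h refl = h

not≡true⇒ : ∀ {b} → not b ≡ true → b ≡ false
not≡true⇒ {false} _ = refl

≡ᵇ-true⁺ : ∀ {m n} → m ≡ n → (m ≡ᵇ n) ≡ true
≡ᵇ-true⁺ {m} {n} = dec-true (m ≟ n)

≡ᵇ-false⁺ : ∀ {m n} → m ≢ n → (m ≡ᵇ n) ≡ false
≡ᵇ-false⁺ {m} {n} = dec-false (m ≟ n)

≡ᵇ-true⁻ : ∀ {m n} → (m ≡ᵇ n) ≡ true → m ≡ n
≡ᵇ-true⁻ {m} {n} h = ≡ᵇ⇒≡ m n (Equivalence.from T-≡ h)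

≡ᵇ-false⁻ : ∀ {m n} → (m ≡ᵇ n) ≡ false → m ≢ n
≡ᵇ-false⁻ {m} h refl with () ← trans (sym (≡ᵇ-true⁺ {m} refl)) h

vec-ext : ∀ {m} {v w : Vec Bool m} → (∀ i → lookup v i ≡ lookup w i) → v ≡ w
vec-ext {v = v} {w} h = trans (sym (tabulate∘lookup v)) (trans (tabulate-cong h) (tabulate∘lookup w))

xnor≡true⇒≡ : ∀ a b → (a xor b xor true) ≡ true → a ≡ b
xnor≡true⇒≡ true  true  _ = refl
xnor≡true⇒≡ false false _ = refl

xnor-comm : ∀ a b → (a xor b xor true) ≡ (b xor a xor true)
xnor-comm a b = trans (sym (xor-assoc a b true)) (trans (cong (_xor true) (xor-comm a b)) (xor-assoc b a true))

indicator : Bool → ℕ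
indicator b = if b then 1 else 0

findBelow : (f : ℕ → Bool) → ∀ m → (∃ λ k → k < m × f k ≡ true) ⊎ (∀ k → k < m → f k ≡ false)
findBelow f zero = inj₂ (λ k ())
findBelow f (suc m) with f m in eq | findBelow f m
... | true  | _                      = inj₁ (m , ≤-refl , eq)
... | false | inj₁ (k , k<m , fk)    = inj₁ (k , m<n⇒m<1+n k<m , fk)
... | false | inj₂ none              = inj₂ λ k k<1+m → [ none k , (λ { refl → eq }) ]′ (m<1+n⇒m<n∨m≡n k<1+m)

module Sums where
  open import Data.Nat using (_+_; _*_)

  sumBy : {A : Set} → (A → ℕ) → List A → ℕ
  sumBy g []       = 0
  sumBy g (x ∷ xs) = g x + sumBy g xs

  module _ {A : Set} where

    sumBy-++ : ∀ (g : A → ℕ) xs ys → sumBy g (xs ++ ys) ≡ sumBy g xs + sumBy g ys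
    sumBy-++ g []       ys = refl
    sumBy-++ g (x ∷ xs) ys = trans (cong (g x +_) (sumBy-++ g xs ys)) (sym (+-assoc (g x) _ _))

    sum-map-filterᵇ : ∀ (w : A → ℕ) f xs →
                      sum (map w (filterᵇ f xs)) ≡ sumBy (λ x → if f x then w x else 0) xs
    sum-map-filterᵇ w f []       = refl
    sum-map-filterᵇ w f (x ∷ xs) with f x
    ... | true  = cong (w x +_) (sum-map-filterᵇ w f xs)
    ... | false = sum-map-filterᵇ w f xs

    length-filterᵇ : ∀ (f : A → Bool) xs → length (filterᵇ f xs) ≡ sumBy (indicator ∘ f) xs
    length-filterᵇ f []       = refl
    length-filterᵇ f (x ∷ xs) with f x
    ... | true  = cong suc (length-filterᵇ f xs)
    ... | false = length-filterᵇ f xs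

  sumBelow : (ℕ → ℕ) → ℕ → ℕ
  sumBelow f m = sumBy f (downFrom m)

  sumBy-applyDownFrom : ∀ {A : Set} (g : A → ℕ) f m → sumBy g (applyDownFrom f m) ≡ sumBelow (g ∘ f) m
  sumBy-applyDownFrom g f zero    = refl
  sumBy-applyDownFrom g f (suc m) = cong (g (f m) +_) (sumBy-applyDownFrom g f m)

  sumBelow-cong : ∀ {f g} m → (∀ j → j < m → f j ≡ g j) → sumBelow f m ≡ sumBelow g m
  sumBelow-cong zero    h = refl
  sumBelow-cong (suc m) h = cong₂ _+_ (h m ≤-refl) (sumBelow-cong m (λ j j<m → h j (m<n⇒m<1+n j<m)))

  sumBelow-const : ∀ {f} m c → (∀ j → j < m → f j ≡ c) → sumBelow f m ≡ m * c
  sumBelow-const zero    c h = refl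
  sumBelow-const (suc m) c h = cong₂ _+_ (h m ≤-refl) (sumBelow-const m c (λ j j<m → h j (m<n⇒m<1+n j<m)))

  sumBelow-zero : ∀ {f} m → (∀ j → j < m → f j ≡ 0) → sumBelow f m ≡ 0
  sumBelow-zero m h = trans (sumBelow-const m 0 h) (*-zeroʳ m)

  sumBelow-+ : ∀ f g m → sumBelow f m + sumBelow g m ≡ sumBelow (λ k → f k + g k) m
  sumBelow-+ f g zero    = refl
  sumBelow-+ f g (suc m) = begin
    (f m + sumBelow f m) + (g m + sumBelow g m) ≡⟨ +-interchange (f m) (sumBelow f m) (g m) (sumBelow g m) ⟩
    (f m + g m) + (sumBelow f m + sumBelow g m) ≡⟨ cong ((f m + g m) +_) (sumBelow-+ f g m) ⟩
    (f m + g m) + sumBelow (λ k → f k + g k) m ∎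
    where open ≡-Reasoning

  sumBelow-indicator : ∀ c w m → c < m → sumBelow (λ k → if c ≡ᵇ k then w else 0) m ≡ w
  sumBelow-indicator c w (suc m) c<1+m with m<1+n⇒m<n∨m≡n c<1+m
  ... | inj₁ c<m rewrite ≡ᵇ-false⁺ (<⇒≢ c<m) = sumBelow-indicator c w m c<m
  ... | inj₂ refl rewrite ≡ᵇ-true⁺ (refl {x = c}) =
    trans (cong (w +_) (sumBelow-zero c below)) (+-identityʳ w)
    where
    below : ∀ j → j < c → (if c ≡ᵇ j then w else 0) ≡ 0
    below j j<c rewrite ≡ᵇ-false⁺ (>⇒≢ j<c) = refl

  sumBelow-coindicator : ∀ c m → c < m → sumBelow (λ k → indicator (not (c ≡ᵇ k))) m + 1 ≡ m
  sumBelow-coindicator c m c<m = begin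
    sumBelow f m + 1               ≡⟨ cong (sumBelow f m +_) (sym (sumBelow-indicator c 1 m c<m)) ⟩
    sumBelow f m + sumBelow g m    ≡⟨ sumBelow-+ f g m ⟩
    sumBelow (λ k → f k + g k) m   ≡⟨ sumBelow-const m 1 (λ k _ → one (c ≡ᵇ k)) ⟩
    m * 1                          ≡⟨ *-identityʳ m ⟩
    m ∎
    where
    open ≡-Reasoning
    f g : ℕ → ℕ
    f k = indicator (not (c ≡ᵇ k))
    g k = if c ≡ᵇ k then 1 else 0
    one : ∀ b → indicator (not b) + (if b then 1 else 0) ≡ 1
    one true  = refl
    one false = refl

  sumBelow-split : ∀ f a b → sumBelow f (a + b) ≡ sumBelow (λ k → f (a + k)) b + sumBelow f a
  sumBelow-split f a zero    rewrite +-identityʳ a = refl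
  sumBelow-split f a (suc b) rewrite +-suc a b =
    trans (cong (f (a + b) +_) (sumBelow-split f a b)) (sym (+-assoc (f (a + b)) _ _))

  sumBelow-residue : ∀ d .{{_ : NonZero d}} j w → j < d → ∀ t →
                     sumBelow (λ a → if a % d ≡ᵇ j then w else 0) (d * t) ≡ t * w
  sumBelow-residue d j w j<d zero    rewrite *-zeroʳ d = refl
  sumBelow-residue d j w j<d (suc t) = begin
    sumBelow f (d * suc t)                        ≡⟨ cong (sumBelow f) (trans (*-suc d t) (+-comm d (d * t))) ⟩
    sumBelow f (d * t + d)                        ≡⟨ sumBelow-split f (d * t) d ⟩
    sumBelow (λ k → f (d * t + k)) d + sumBelow f (d * t)
      ≡⟨ cong₂ _+_ (trans (sumBelow-cong d period) (sumBelow-indicator j w d j<d)) (sumBelow-residue d j w j<d t) ⟩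
    w + t * w ∎
    where
    open ≡-Reasoning
    f : ℕ → ℕ
    f a = if a % d ≡ᵇ j then w else 0
    period : ∀ k → k < d → f (d * t + k) ≡ (if j ≡ᵇ k then w else 0)
    period k k<d rewrite %-remove-+ˡ {d * t} k (m∣m*n {d} t) | m<n⇒m%n≡m k<d with k ≟ j
    ... | yes refl = refl
    ... | no k≢j rewrite ≡ᵇ-false⁺ k≢j | ≡ᵇ-false⁺ (k≢j ∘ sym) = refl

  sumBelow-*ʳ : ∀ c m → sumBelow (λ j → j * c) m ≡ sumBelow id m * c
  sumBelow-*ʳ c zero    = refl
  sumBelow-*ʳ c (suc m) = trans (cong (m * c +_) (sumBelow-*ʳ c m)) (sym (*-distribʳ-+ c m (sumBelow id m)))

  2*sumBelow-id+m≡m*m : ∀ m → 2 * sumBelow id m + m ≡ m * m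
  2*sumBelow-id+m≡m*m zero    = refl
  2*sumBelow-id+m≡m*m (suc m) = begin
    2 * (m + S) + suc m       ≡⟨ regroup m S ⟩
    (2 * S + m) + (2 * m + 1) ≡⟨ cong (_+ (2 * m + 1)) (2*sumBelow-id+m≡m*m m) ⟩
    m * m + (2 * m + 1)       ≡⟨ solve (m ∷ []) ⟩
    suc m * suc m ∎
    where
    open ≡-Reasoning
    S = sumBelow id m
    regroup : ∀ m S → 2 * (m + S) + suc m ≡ (2 * S + m) + (2 * m + 1)
    regroup = solve-∀

  sumBy-↭ : ∀ {A : Set} (g : A → ℕ) {xs ys} → xs ↭ ys → sumBy g xs ≡ sumBy g ys
  sumBy-↭ g ↭.refl         = refl
  sumBy-↭ g (↭.prep x p)   = cong (g x +_) (sumBy-↭ g p)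
  sumBy-↭ g (↭.swap x y p) = trans (sym (+-assoc (g x) (g y) _))
    (trans (cong₂ _+_ (+-comm (g x) (g y)) (sumBy-↭ g p)) (+-assoc (g y) (g x) _))
  sumBy-↭ g (↭.trans p q)  = trans (sumBy-↭ g p) (sumBy-↭ g q)

open Sums

module Residues where
  open import Data.Nat using (_+_; _*_)

  ∣m∣n⇒∣m∸n : ∀ {d m n} → n ≤ m → d ∣ m → d ∣ n → d ∣ m ∸ n
  ∣m∣n⇒∣m∸n n≤m d∣m d∣n = ∣m+n∣m⇒∣n (subst (_ ∣_) (sym (m+[n∸m]≡n n≤m)) d∣m) d∣n

  hasResidue : (d : ℕ) .{{_ : NonZero d}} → ℕ → ℕ → Bool
  hasResidue d j k = k % d ≡ᵇ j

  module _ (d : ℕ) .{{_ : NonZero d}} where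

    [m%d+n]%d≡[m+n]%d : ∀ m k → (m % d + k) % d ≡ (m + k) % d
    [m%d+n]%d≡[m+n]%d m k = begin
      (m % d + k) % d         ≡⟨ %-distribˡ-+ (m % d) k d ⟩
      (m % d % d + k % d) % d ≡⟨ cong (λ z → (z + k % d) % d) (m%n%n≡m%n m d) ⟩
      (m % d + k % d) % d     ≡⟨ %-distribˡ-+ m k d ⟨
      (m + k) % d             ∎
      where open ≡-Reasoning

    [m+[N∸k]]%d≡0⇒m≡k : ∀ {N} m k → d ∣ N → k ≤ N → (m + (N ∸ k)) % d ≡ 0 → m % d ≡ k % d
    [m+[N∸k]]%d≡0⇒m≡k {N} m k d∣N k≤N eq = begin
      m % d                       ≡⟨ %-remove-+ʳ m d∣N ⟨
      (m + N) % d                 ≡⟨ cong (λ z → (m + z) % d) (m∸n+n≡m k≤N) ⟨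
      (m + (N ∸ k + k)) % d       ≡⟨ cong (_% d) (+-assoc m (N ∸ k) k) ⟨
      (m + (N ∸ k) + k) % d       ≡⟨ [m%d+n]%d≡[m+n]%d (m + (N ∸ k)) k ⟨
      ((m + (N ∸ k)) % d + k) % d ≡⟨ cong (λ z → (z + k) % d) eq ⟩
      k % d                       ∎
      where open ≡-Reasoning

    m≡k⇒[m+[N∸k]]%d≡0 : ∀ {N} m k → d ∣ N → k ≤ N → m % d ≡ k % d → (m + (N ∸ k)) % d ≡ 0
    m≡k⇒[m+[N∸k]]%d≡0 {N} m k d∣N k≤N eq = begin
      (m + (N ∸ k)) % d     ≡⟨ [m%d+n]%d≡[m+n]%d m (N ∸ k) ⟨
      (m % d + (N ∸ k)) % d ≡⟨ cong (λ z → (z + (N ∸ k)) % d) eq ⟩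
      (k % d + (N ∸ k)) % d ≡⟨ [m%d+n]%d≡[m+n]%d k (N ∸ k) ⟩
      (k + (N ∸ k)) % d     ≡⟨ cong (_% d) (m+[n∸m]≡n k≤N) ⟩
      N % d                 ≡⟨ n∣m⇒m%n≡0 N d d∣N ⟩
      0                     ∎
      where open ≡-Reasoning

    hasResidue-shift : ∀ {N} m k → d ∣ N → k ≤ N → hasResidue d 0 (m + (N ∸ k)) ≡ hasResidue d (k % d) m
    hasResidue-shift m k d∣N k≤N = ⇔→≡ {z = true} (mk⇔
      (λ h → ≡ᵇ-true⁺ ([m+[N∸k]]%d≡0⇒m≡k m k d∣N k≤N (≡ᵇ-true⁻ h)))
      (λ h → ≡ᵇ-true⁺ (m≡k⇒[m+[N∸k]]%d≡0 m k d∣N k≤N (≡ᵇ-true⁻ h))))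

  hasResidue-< : ∀ d .{{_ : NonZero d}} {j k} → k < d → hasResidue d j k ≡ (k ≡ᵇ j)
  hasResidue-< d {j} k<d = cong (_≡ᵇ j) (m<n⇒m%n≡m k<d)

  residue-self : ∀ d .{{_ : NonZero d}} {j} → j < d → hasResidue d j j ≡ true
  residue-self d {j} j<d = trans (hasResidue-< d j<d) (≡ᵇ-true⁺ (refl {x = j}))

  residue-other : ∀ d .{{_ : NonZero d}} {j k} → j < d → j ≢ k → hasResidue d k j ≡ false
  residue-other d j<d j≢k = trans (hasResidue-< d j<d) (≡ᵇ-false⁺ j≢k)

  coprime⇒inverse : ∀ {a d} .{{_ : NonZero d}} → Coprime a d → ∃ λ m → (a * m) % d ≡ 1 % d
  coprime⇒inverse {a} {d} cop with coprime-Bézout cop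
  ... | Bézout.+- x y eq = x , (begin
    (a * x) % d     ≡⟨ cong (_% d) (trans (*-comm a x) (sym eq)) ⟩
    (1 + y * d) % d ≡⟨ [m+kn]%n≡m%n 1 y d ⟩
    1 % d           ∎)
    where open ≡-Reasoning
  coprime⇒inverse {a} {suc t} cop | Bézout.-+ x y eq = x * t , (begin
    (a * (x * t)) % suc t          ≡⟨ [m+n]%n≡m%n (a * (x * t)) (suc t) ⟨
    (a * (x * t) + suc t) % suc t  ≡⟨ cong (_% suc t) shift ⟩
    (1 + y * t * suc t) % suc t    ≡⟨ [m+kn]%n≡m%n 1 (y * t) (suc t) ⟩
    1 % suc t                      ∎)
    where
    open ≡-Reasoning
    -- x a ≡ -1, so x (d - 1) inverts a modulo d = t + 1
    shift : a * (x * t) + suc t ≡ 1 + y * t * suc t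
    shift = begin
      a * (x * t) + suc t   ≡⟨ solve (a ∷ x ∷ t ∷ []) ⟩
      1 + (1 + x * a) * t   ≡⟨ cong (λ z → 1 + z * t) eq ⟩
      1 + y * suc t * t     ≡⟨ solve (y ∷ t ∷ []) ⟩
      1 + y * t * suc t     ∎

open Residues

module ZagrebPolynomial where
  open import Data.Nat using (_+_; _*_)

  -- Adding p (2p + 1)² to both sides avoids the subtraction in 2 Σj = p² - p.
  zagreb-polynomial : ∀ p Σj → 2 * Σj + p ≡ p * p →
    2 * (suc p * suc p + 2 * (p * (suc p * (2 * p + 1))) + Σj * ((2 * p + 1) * (2 * p + 1)) + p * p * (2 * p + 1))
      ≡ (((4 * p + 12) * p + 13) * p + 7) * p + 2
  zagreb-polynomial p Σj 2Σj+p≡p² = +-cancelʳ-≡ (p * ((2 * p + 1) * (2 * p + 1))) _ _ (begin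
    2 * (suc p * suc p + 2 * (p * (suc p * (2 * p + 1))) + Σj * ((2 * p + 1) * (2 * p + 1)) + p * p * (2 * p + 1))
      + p * ((2 * p + 1) * (2 * p + 1))
      ≡⟨ solve (p ∷ Σj ∷ []) ⟩
    2 * (suc p * suc p + 2 * (p * (suc p * (2 * p + 1))) + p * p * (2 * p + 1))
      + (2 * Σj + p) * ((2 * p + 1) * (2 * p + 1))
      ≡⟨ cong (λ z → 2 * (suc p * suc p + 2 * (p * (suc p * (2 * p + 1))) + p * p * (2 * p + 1))
                     + z * ((2 * p + 1) * (2 * p + 1))) 2Σj+p≡p² ⟩
    2 * (suc p * suc p + 2 * (p * (suc p * (2 * p + 1))) + p * p * (2 * p + 1))
      + p * p * ((2 * p + 1) * (2 * p + 1))
      ≡⟨ solve (p ∷ []) ⟩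
    (((4 * p + 12) * p + 13) * p + 7) * p + 2 + p * ((2 * p + 1) * (2 * p + 1)) ∎)
    where open ≡-Reasoning

open ZagrebPolynomial

module DihedralGraph (n : ℕ) .{{_ : NonZero n}} where
  open import Data.Nat using (_+_; _*_)
  open Dihedral n

  ∈-elems : ∀ x → x ∈ elems
  ∈-elems (i , false) = ∈-++⁺ˡ (∈-map⁺ (λ j → (j , false)) (∈-allFin i))
  ∈-elems (i , true)  = ∈-++⁺ʳ (map (λ j → (j , false)) (allFin n)) (∈-map⁺ (λ j → (j , true)) (∈-allFin i))

  all-elems⁻ : ∀ f → all f elems ≡ true → ∀ x → f x ≡ true
  all-elems⁻ f h x = all≡true⁻ f elems h (∈-elems x)

  all-elems⁺ : ∀ f → (∀ x → f x ≡ true) → all f elems ≡ true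
  all-elems⁺ f h = all≡true⁺ f elems (λ {x} _ → h x)

  any-elems⁺ : ∀ f x → f x ≡ true → any f elems ≡ true
  any-elems⁺ f x = any≡true⁺ f (∈-elems x)

  ∈-allVecs : ∀ m (v : Vec Bool m) → v ∈ allVecs m
  ∈-allVecs zero    []ᵥ      = here refl
  ∈-allVecs (suc m) (b ∷ᵥ v) = extend (allVecs m) (∈-allVecs m v)
    where
    extend : ∀ {c} vs → v ∈ vs → (c ∷ᵥ v) ∈ concatMap (λ w → (true ∷ᵥ w) ∷ (false ∷ᵥ w) ∷ []) vs
    extend {true}  (w ∷ ws) (here refl)  = here refl
    extend {false} (w ∷ ws) (here refl)  = there (here refl)
    extend         (w ∷ ws) (there v∈ws) = there (there (extend ws v∈ws))

  allVecs-unique : ∀ m → Unique (allVecs m)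
  allVecs-unique zero    = All.[] ∷ []
  allVecs-unique (suc m) = extend (allVecs m) (allVecs-unique m)
    where
    ∷-≢ : ∀ {b c} {v w : Vec Bool m} → v ≢ w → (b ∷ᵥ v) ≢ (c ∷ᵥ w)
    ∷-≢ v≢w refl = v≢w refl
    fresh : ∀ {b v} ws → All.All (v ≢_) ws →
            All.All ((b ∷ᵥ v) ≢_) (concatMap (λ w → (true ∷ᵥ w) ∷ (false ∷ᵥ w) ∷ []) ws)
    fresh []       All.[]         = All.[]
    fresh (w ∷ ws) (v≢w All.∷ vs) = ∷-≢ v≢w All.∷ ∷-≢ v≢w All.∷ fresh ws vs
    extend : ∀ vs → Unique vs → Unique (concatMap (λ w → (true ∷ᵥ w) ∷ (false ∷ᵥ w) ∷ []) vs)
    extend []       []       = []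
    extend (w ∷ ws) (a ∷ u) = ((λ ()) All.∷ fresh ws a) ∷ fresh ws a ∷ extend ws u

  ∈-allSubs : ∀ H → H ∈ allSubs
  ∈-allSubs (R , S) = ∈-cartesianProduct⁺ (∈-allVecs n R) (∈-allVecs n S)

  allSubs-unique : Unique allSubs
  allSubs-unique = Unique.cartesianProduct⁺ (allVecs-unique n) (allVecs-unique n)

  isVertex : Sub → Bool
  isVertex H = isSubgroup H ∧ nontrivial H ∧ proper H

  ↭-vertices : ∀ L → Unique L → (∀ H → isVertex H ≡ true → H ∈ L) → (∀ {H} → H ∈ L → isVertex H ≡ true) →
               L ↭ vertices
  ↭-vertices L L-unique complete sound = ∼bag⇒↭ (unique∧set⇒bag L-unique
    (Unique.filter⁺ (T? ∘ isVertex) allSubs-unique)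
    (mk⇔ (λ H∈L → ∈-filterᵇ⁺ isVertex (∈-allSubs _) (sound H∈L))
         (λ H∈V → complete _ (∈-filterᵇ⁻ isVertex allSubs H∈V))))

  sameSub⇒≡ : ∀ H K → sameSub H K ≡ true → H ≡ K
  sameSub⇒≡ (R , S) (R′ , S′) h = cong₂ _,_ (vec-ext (λ i → same (i , false))) (vec-ext (λ i → same (i , true)))
    where
    same : ∀ x → x ∈ᵇ (R , S) ≡ x ∈ᵇ (R′ , S′)
    same x = xnor≡true⇒≡ _ _ (all-elems⁻ _ h x)

  meets : Sub → Sub → Bool
  meets H K = any (λ x → not (isE x) ∧ (x ∈ᵇ H) ∧ (x ∈ᵇ K)) elems

  adj-sym : ∀ H K → adj H K ≡ adj K H
  adj-sym H K = cong₂ (λ same common → not same ∧ common)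
    (cong and (map-cong (λ x → xnor-comm (x ∈ᵇ H) (x ∈ᵇ K)) elems))
    (cong or (map-cong (λ x → cong (not (isE x) ∧_) (∧-comm (x ∈ᵇ H) (x ∈ᵇ K))) elems))

  adj-irrefl : ∀ H → adj H H ≡ false
  adj-irrefl H = cong (λ same → not same ∧ meets H H) (all-elems⁺ _ self)
    where
    self : ∀ x → ((x ∈ᵇ H) xor (x ∈ᵇ H) xor true) ≡ true
    self x = trans (sym (xor-assoc (x ∈ᵇ H) (x ∈ᵇ H) true)) (cong (_xor true) (xor-same (x ∈ᵇ H)))

  adj≡meets : ∀ H K → H ≢ K → adj H K ≡ meets H K
  adj≡meets H K H≢K with sameSub H K in eq
  ... | true  = ⊥-elim (H≢K (sameSub⇒≡ H K eq))
  ... | false = refl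

  weight : Sub → Sub → ℕ
  weight u v = if adj u v then deg u * deg v else 0

  weight-sym : ∀ u v → weight u v ≡ weight v u
  weight-sym u v rewrite adj-sym u v with adj v u
  ... | true  = *-comm (deg u) (deg v)
  ... | false = refl

  weight-adj : ∀ {u v} → adj u v ≡ true → weight u v ≡ deg u * deg v
  weight-adj {u} {v} eq rewrite eq = refl

  weight-nonadj : ∀ {u v} → adj u v ≡ false → weight u v ≡ 0
  weight-nonadj {u} {v} eq rewrite eq = refl

  edgeSum-∷ : ∀ u vs → edgeSum (u ∷ vs) ≡ sumBy (weight u) vs + edgeSum vs
  edgeSum-∷ u vs = cong (_+ edgeSum vs) (sum-map-filterᵇ (λ v → deg u * deg v) (adj u) vs)

  edgeSum-↭ : ∀ {xs ys} → xs ↭ ys → edgeSum xs ≡ edgeSum ys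
  edgeSum-↭ ↭.refl = refl
  edgeSum-↭ (↭.prep {xs} {ys} x p) = begin
    edgeSum (x ∷ xs)                        ≡⟨ edgeSum-∷ x xs ⟩
    sumBy (weight x) xs + edgeSum xs        ≡⟨ cong₂ _+_ (sumBy-↭ (weight x) p) (edgeSum-↭ p) ⟩
    sumBy (weight x) ys + edgeSum ys        ≡⟨ edgeSum-∷ x ys ⟨
    edgeSum (x ∷ ys)                        ∎
    where open ≡-Reasoning
  edgeSum-↭ (↭.swap {xs} {ys} x y p) = begin
    edgeSum (x ∷ y ∷ xs)
      ≡⟨ trans (edgeSum-∷ x (y ∷ xs)) (cong (weight x y + W x xs +_) (edgeSum-∷ y xs)) ⟩
    (weight x y + W x xs) + (W y xs + edgeSum xs)
      ≡⟨ +-interchange (weight x y) (W x xs) (W y xs) (edgeSum xs) ⟩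
    (weight x y + W y xs) + (W x xs + edgeSum xs)
      ≡⟨ cong₂ (λ a b → (a + W y xs) + b) (weight-sym x y) (cong₂ _+_ (sumBy-↭ (weight x) p) (edgeSum-↭ p)) ⟩
    (weight y x + W y xs) + (W x ys + edgeSum ys)
      ≡⟨ cong (λ b → (weight y x + b) + (W x ys + edgeSum ys)) (sumBy-↭ (weight y) p) ⟩
    (weight y x + W y ys) + (W x ys + edgeSum ys)
      ≡⟨ trans (edgeSum-∷ y (x ∷ ys)) (cong (weight y x + W y ys +_) (edgeSum-∷ x ys)) ⟨
    edgeSum (y ∷ x ∷ ys) ∎
    where
    open ≡-Reasoning
    W : Sub → List Sub → ℕ
    W u = sumBy (weight u)
  edgeSum-↭ (↭.trans p q) = trans (edgeSum-↭ p) (edgeSum-↭ q)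

  cross : List Sub → List Sub → ℕ
  cross xs ys = sumBy (λ u → sumBy (weight u) ys) xs

  edgeSum-++ : ∀ xs ys → edgeSum (xs ++ ys) ≡ edgeSum xs + edgeSum ys + cross xs ys
  edgeSum-++ []       ys = sym (+-identityʳ (edgeSum ys))
  edgeSum-++ (u ∷ xs) ys = begin
    edgeSum (u ∷ xs ++ ys)
      ≡⟨ edgeSum-∷ u (xs ++ ys) ⟩
    sumBy (weight u) (xs ++ ys) + edgeSum (xs ++ ys)
      ≡⟨ cong₂ _+_ (sumBy-++ (weight u) xs ys) (edgeSum-++ xs ys) ⟩
    (W xs + W ys) + (edgeSum xs + edgeSum ys + cross xs ys)
      ≡⟨ regroup (W xs) (W ys) (edgeSum xs) (edgeSum ys) (cross xs ys) ⟩
    W xs + edgeSum xs + edgeSum ys + (W ys + cross xs ys)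
      ≡⟨ cong (λ z → z + edgeSum ys + (W ys + cross xs ys)) (edgeSum-∷ u xs) ⟨
    edgeSum (u ∷ xs) + edgeSum ys + cross (u ∷ xs) ys ∎
    where
    open ≡-Reasoning
    W = sumBy (weight u)
    regroup : ∀ a b c d e → (a + b) + (c + d + e) ≡ a + c + d + (b + e)
    regroup = solve-∀

  deg-↭ : ∀ {L} → L ↭ vertices → ∀ u → deg u ≡ sumBy (indicator ∘ adj u) L
  deg-↭ {L} L↭ u = trans (sym (↭-length (filter-↭ (T? ∘ adj u) L↭))) (length-filterᵇ (adj u) L)

  edgeSum-applyDownFrom : ∀ f m → edgeSum (applyDownFrom f m) ≡ sumBelow (λ j → sumBelow (λ k → weight (f j) (f k)) j) m
  edgeSum-applyDownFrom f zero    = refl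
  edgeSum-applyDownFrom f (suc m) = trans (edgeSum-∷ (f m) (applyDownFrom f m))
    (cong₂ _+_ (sumBy-applyDownFrom (weight (f m)) f m) (edgeSum-applyDownFrom f m))

module DihedralSubgroups (n : ℕ) .{{_ : NonZero n}} where
  open import Data.Nat using (_+_; _*_)
  open Dihedral n
  open DihedralGraph n

  toℕ-mod : ∀ a → toℕ (a mod n) ≡ a % n
  toℕ-mod a = toℕ-fromℕ< _

  mod-cong : ∀ {a b} → a % n ≡ b % n → a mod n ≡ b mod n
  mod-cong {a} {b} eq = toℕ-injective (trans (toℕ-mod a) (trans eq (sym (toℕ-mod b))))

  toℕ-mod-id : (i : Fin n) → toℕ i mod n ≡ i
  toℕ-mod-id i = toℕ-injective (trans (toℕ-mod (toℕ i)) (m<n⇒m%n≡m (toℕ<n i)))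

  hasRot hasRef : Sub → ℕ → Bool
  hasRot (R , S) a = lookup R (a mod n)
  hasRef (R , S) a = lookup S (a mod n)

  hasRot-% : ∀ H {a b} → a % n ≡ b % n → hasRot H a ≡ hasRot H b
  hasRot-% (R , S) eq = cong (lookup R) (mod-cong eq)

  hasRef-% : ∀ H {a b} → a % n ≡ b % n → hasRef H a ≡ hasRef H b
  hasRef-% (R , S) eq = cong (lookup S) (mod-cong eq)

  hasRot-toℕ : ∀ H i → hasRot H (toℕ i) ≡ (i , false) ∈ᵇ H
  hasRot-toℕ (R , S) i = cong (lookup R) (toℕ-mod-id i)

  hasRef-toℕ : ∀ H i → hasRef H (toℕ i) ≡ (i , true) ∈ᵇ H
  hasRef-toℕ (R , S) i = cong (lookup S) (toℕ-mod-id i)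

  hasRot-ext : ∀ H (F : ℕ → Bool) → (∀ k → F (k % n) ≡ F k) → (∀ k → k < n → hasRot H k ≡ F k) → ∀ k → hasRot H k ≡ F k
  hasRot-ext H F F-% h k = trans (hasRot-% H (sym (m%n%n≡m%n k n))) (trans (h (k % n) (m%n<n k n)) (F-% k))

  module Closure {R S : Vec Bool n} (H-sub : isSubgroup (R , S) ≡ true) where

    private
      H : Sub
      H = R , S

    ·-closed : ∀ x y → x ∈ᵇ H ≡ true → y ∈ᵇ H ≡ true → (x · y) ∈ᵇ H ≡ true
    ·-closed x y = ⇒-elim₂ (all-elems⁻ (λ y → not (x ∈ᵇ H) ∨ not (y ∈ᵇ H) ∨ ((x · y) ∈ᵇ H))
      (all-elems⁻ (λ x → all (λ y → not (x ∈ᵇ H) ∨ not (y ∈ᵇ H) ∨ ((x · y) ∈ᵇ H)) elems)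
        (proj₁ (∧-true⁻ (proj₂ (∧-true⁻ {e ∈ᵇ H} H-sub)))) x) y)

    rot-0 : hasRot H 0 ≡ true
    rot-0 = proj₁ (∧-true⁻ H-sub)

    rot-+ : ∀ {a b} → hasRot H a ≡ true → hasRot H b ≡ true → hasRot H (a + b) ≡ true
    rot-+ {a} {b} ha hb = trans (hasRot-% H sum-mod) (·-closed (a mod n , false) (b mod n , false) ha hb)
      where
      sum-mod : (a + b) % n ≡ (toℕ (a mod n) + toℕ (b mod n)) % n
      sum-mod rewrite toℕ-mod a | toℕ-mod b = %-distribˡ-+ a b n

    rot-ref-+ : ∀ {a b} → hasRot H a ≡ true → hasRef H b ≡ true → hasRef H (a + b) ≡ true
    rot-ref-+ {a} {b} ha hb = trans (hasRef-% H sum-mod) (·-closed (a mod n , false) (b mod n , true) ha hb)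
      where
      sum-mod : (a + b) % n ≡ (toℕ (a mod n) + toℕ (b mod n)) % n
      sum-mod rewrite toℕ-mod a | toℕ-mod b = %-distribˡ-+ a b n

    ref-ref-∸ : ∀ {a b} → hasRef H a ≡ true → hasRef H b ≡ true → hasRot H (a + (n ∸ b % n)) ≡ true
    ref-ref-∸ {a} {b} ha hb = trans (hasRot-% H diff-mod) (·-closed (a mod n , true) (b mod n , true) ha hb)
      where
      diff-mod : (a + (n ∸ b % n)) % n ≡ (toℕ (a mod n) + (n ∸ toℕ (b mod n))) % n
      diff-mod rewrite toℕ-mod a | toℕ-mod b = sym ([m%d+n]%d≡[m+n]%d n a (n ∸ b % n))

    rot-* : ∀ {a} → hasRot H a ≡ true → ∀ m → hasRot H (a * m) ≡ true
    rot-* {a} ha zero    rewrite *-zeroʳ a = rot-0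
    rot-* {a} ha (suc m) rewrite *-suc a m = rot-+ ha (rot-* ha m)

    rot-generated : ∀ {a t} m → hasRot H a ≡ true → (a * m) % n ≡ t % n → hasRot H t ≡ true
    rot-generated m ha eq = trans (sym (hasRot-% H eq)) (rot-* ha m)

    -- Given r^s s ∈ H, r^b s ∈ H iff r^(b - s) ∈ H, with n ∸ s standing for -s.
    reflections : (∀ k → hasRef H k ≡ false) ⊎ ∃ λ s → s < n × ∀ b → hasRef H b ≡ hasRot H (b + (n ∸ s))
    reflections with findBelow (hasRef H) n
    ... | inj₂ none = inj₁ λ k → trans (hasRef-% H (sym (m%n%n≡m%n k n))) (none (k % n) (m%n<n k n))
    ... | inj₁ (s , s<n , hs) = inj₂ (s , s<n , λ b → ⇔→≡ {z = true} (mk⇔ (to b) (from b)))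
      where
      to : ∀ b → hasRef H b ≡ true → hasRot H (b + (n ∸ s)) ≡ true
      to b hb = subst (λ z → hasRot H (b + (n ∸ z)) ≡ true) (m<n⇒m%n≡m s<n) (ref-ref-∸ hb hs)
      from : ∀ b → hasRot H (b + (n ∸ s)) ≡ true → hasRef H b ≡ true
      from b hb = trans (hasRef-% H back) (rot-ref-+ hb hs)
        where
        back : b % n ≡ (b + (n ∸ s) + s) % n
        back rewrite +-assoc b (n ∸ s) s | m∸n+n≡m (<⇒≤ s<n) = sym ([m+n]%n≡m%n b n)

  fromPredicates : (ℕ → Bool) → (ℕ → Bool) → Sub
  fromPredicates F G = tabulate (F ∘ toℕ) , tabulate (G ∘ toℕ)

  hasRot-fromPredicates : ∀ F G a → hasRot (fromPredicates F G) a ≡ F (a % n)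
  hasRot-fromPredicates F G a = trans (lookup∘tabulate (F ∘ toℕ) (a mod n)) (cong F (toℕ-mod a))

  hasRef-fromPredicates : ∀ F G a → hasRef (fromPredicates F G) a ≡ G (a % n)
  hasRef-fromPredicates F G a = trans (lookup∘tabulate (G ∘ toℕ) (a mod n)) (cong G (toℕ-mod a))

  ≡-fromPredicates : ∀ {R S} F G → (∀ k → hasRot (R , S) k ≡ F k) → (∀ k → hasRef (R , S) k ≡ G k) →
                     (R , S) ≡ fromPredicates F G
  ≡-fromPredicates {R} {S} F G hF hG = cong₂ _,_
    (vec-ext λ i → trans (sym (hasRot-toℕ (R , S) i)) (trans (hF (toℕ i)) (sym (lookup∘tabulate (F ∘ toℕ) i))))
    (vec-ext λ i → trans (sym (hasRef-toℕ (R , S) i)) (trans (hG (toℕ i)) (sym (lookup∘tabulate (G ∘ toℕ) i))))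

  -- The group law (r^a s^x)(r^b s^y) = r^(a ± b) s^(x+y), read on rotation exponents F and reflection exponents G;
  -- n ∸ b stands for -b.
  record SubgroupLaws (F G : ℕ → Bool) : Set where
    field
      F-% : ∀ k → F (k % n) ≡ F k
      G-% : ∀ k → G (k % n) ≡ G k
      F-0 : F 0 ≡ true
      F-+ : ∀ {a b} → F a ≡ true → F b ≡ true → F (a + b) ≡ true
      G-+ : ∀ {a b} → F a ≡ true → G b ≡ true → G (a + b) ≡ true
      G-∸ : ∀ {a b} → b < n → G a ≡ true → F b ≡ true → G (a + (n ∸ b)) ≡ true
      F-∸ : ∀ {a b} → b < n → G a ≡ true → G b ≡ true → F (a + (n ∸ b)) ≡ true
      F-neg : ∀ {a} → a < n → F a ≡ true → F (n ∸ a) ≡ true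

  fromPredicates-isSubgroup : ∀ {F G} → SubgroupLaws F G → isSubgroup (fromPredicates F G) ≡ true
  fromPredicates-isSubgroup {F} {G} laws =
    ∧-true⁺ (rot 0 F-0) (∧-true⁺ (all-elems⁺ _ λ x → all-elems⁺ _ (product x)) (all-elems⁺ _ inverse))
    where
    open SubgroupLaws laws
    H = fromPredicates F G
    rot : ∀ a → F a ≡ true → (a mod n , false) ∈ᵇ H ≡ true
    rot a Fa = trans (hasRot-fromPredicates F G a) (trans (F-% a) Fa)
    ref : ∀ a → G a ≡ true → (a mod n , true) ∈ᵇ H ≡ true
    ref a Ga = trans (hasRef-fromPredicates F G a) (trans (G-% a) Ga)
    F∈ : ∀ i → (i , false) ∈ᵇ H ≡ true → F (toℕ i) ≡ true
    F∈ i = trans (sym (lookup∘tabulate (F ∘ toℕ) i))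
    G∈ : ∀ i → (i , true) ∈ᵇ H ≡ true → G (toℕ i) ≡ true
    G∈ i = trans (sym (lookup∘tabulate (G ∘ toℕ) i))
    product : ∀ x y → (not (x ∈ᵇ H) ∨ not (y ∈ᵇ H) ∨ ((x · y) ∈ᵇ H)) ≡ true
    product (i , false) (j , false) = ⇒-intro₂ λ hi hj → rot _ (F-+ (F∈ i hi) (F∈ j hj))
    product (i , false) (j , true)  = ⇒-intro₂ λ hi hj → ref _ (G-+ (F∈ i hi) (G∈ j hj))
    product (i , true)  (j , false) = ⇒-intro₂ λ hi hj → ref _ (G-∸ (toℕ<n j) (G∈ i hi) (F∈ j hj))
    product (i , true)  (j , true)  = ⇒-intro₂ λ hi hj → rot _ (F-∸ (toℕ<n j) (G∈ i hi) (G∈ j hj))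
    inverse : ∀ x → (not (x ∈ᵇ H) ∨ (inv x ∈ᵇ H)) ≡ true
    inverse (i , false) = ⇒-intro₁ λ hi → rot _ (F-neg (toℕ<n i) (F∈ i hi))
    inverse (i , true)  = ⇒-intro₁ {(i , true) ∈ᵇ H} id

  cyclic : (d : ℕ) .{{_ : NonZero d}} → Sub
  cyclic d = fromPredicates (hasResidue d 0) (λ _ → false)

  dihedral : (d : ℕ) .{{_ : NonZero d}} → ℕ → Sub
  dihedral d j = fromPredicates (hasResidue d 0) (hasResidue d j)

  module _ (d : ℕ) .{{_ : NonZero d}} (d∣n : d ∣ n) where

    hasResidue-% : ∀ j k → hasResidue d j (k % n) ≡ hasResidue d j k
    hasResidue-% j k = cong (_≡ᵇ j) (m∣n⇒o%n%m≡o%m d n k d∣n)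

    hasResidue-+ : ∀ {a b j} → hasResidue d 0 a ≡ true → hasResidue d j b ≡ true → hasResidue d j (a + b) ≡ true
    hasResidue-+ {a} {b} {j} ha hb = trans (cong (_≡ᵇ j) (%-remove-+ˡ b (m%n≡0⇒n∣m a d (≡ᵇ-true⁻ ha)))) hb

    hasResidue-∸ : ∀ {a} → a < n → hasResidue d 0 a ≡ true → d ∣ n ∸ a
    hasResidue-∸ {a} a<n ha = ∣m∣n⇒∣m∸n (<⇒≤ a<n) d∣n (m%n≡0⇒n∣m a d (≡ᵇ-true⁻ ha))

    dihedral-laws : ∀ j → SubgroupLaws (hasResidue d 0) (hasResidue d j)
    dihedral-laws j = record
      { F-%   = hasResidue-% 0
      ; G-%   = hasResidue-% j
      ; F-0   = ≡ᵇ-true⁺ (m*n%n≡0 0 d)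
      ; F-+   = hasResidue-+
      ; G-+   = hasResidue-+
      ; G-∸   = λ {a} b<n ga fb → trans (cong (_≡ᵇ j) (%-remove-+ʳ a (hasResidue-∸ b<n fb))) ga
      ; F-∸   = λ {a} {b} b<n ga gb →
                  ≡ᵇ-true⁺ (m≡k⇒[m+[N∸k]]%d≡0 d a b d∣n (<⇒≤ b<n) (trans (≡ᵇ-true⁻ ga) (sym (≡ᵇ-true⁻ gb))))
      ; F-neg = λ a<n fa → ≡ᵇ-true⁺ (n∣m⇒m%n≡0 _ d (hasResidue-∸ a<n fa))
      }

    cyclic-isSubgroup : isSubgroup (cyclic d) ≡ true
    cyclic-isSubgroup = fromPredicates-isSubgroup record
      { SubgroupLaws (dihedral-laws 0) hiding (G-%; G-+; G-∸; F-∸)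
      ; G-% = λ _ → refl
      ; G-+ = λ _ ()
      ; G-∸ = λ _ ()
      ; F-∸ = λ _ ()
      }

    dihedral-isSubgroup : ∀ j → isSubgroup (dihedral d j) ≡ true
    dihedral-isSubgroup j = fromPredicates-isSubgroup (dihedral-laws j)

    hasRot-cyclic : ∀ a → hasRot (cyclic d) a ≡ hasResidue d 0 a
    hasRot-cyclic a = trans (hasRot-fromPredicates (hasResidue d 0) (λ _ → false) a) (hasResidue-% 0 a)

    hasRef-cyclic : ∀ a → hasRef (cyclic d) a ≡ false
    hasRef-cyclic = hasRef-fromPredicates (hasResidue d 0) (λ _ → false)

    hasRot-dihedral : ∀ j a → hasRot (dihedral d j) a ≡ hasResidue d 0 a
    hasRot-dihedral j a = trans (hasRot-fromPredicates (hasResidue d 0) (hasResidue d j) a) (hasResidue-% 0 a)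

    hasRef-dihedral : ∀ j a → hasRef (dihedral d j) a ≡ hasResidue d j a
    hasRef-dihedral j a = trans (hasRef-fromPredicates (hasResidue d 0) (hasResidue d j) a) (hasResidue-% j a)

  subgroup-shape : ∀ {R S} → isSubgroup (R , S) ≡ true → ∀ d .{{_ : NonZero d}} → d ∣ n →
                   (∀ k → hasRot (R , S) k ≡ hasResidue d 0 k) →
                   (R , S) ≡ cyclic d ⊎ ∃ λ j → j < d × (R , S) ≡ dihedral d j
  subgroup-shape {R} {S} H-sub d d∣n rot with Closure.reflections {R} {S} H-sub
  ... | inj₁ none = inj₁ (≡-fromPredicates _ _ rot none)
  ... | inj₂ (s , s<n , coset) = inj₂ (s % d , m%n<n s d , ≡-fromPredicates _ _ rot λ b →
          trans (coset b) (trans (rot _) (hasResidue-shift d b s d∣n (<⇒≤ s<n))))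

  rotation≢e : ∀ {a} → a % n ≢ 0 → not (isE (a mod n , false)) ≡ true
  rotation≢e {a} a≢0 rewrite toℕ-mod a | ≡ᵇ-false⁺ a≢0 = refl

  reflection≢e : ∀ i → not (isE (i , true)) ≡ true
  reflection≢e i = cong not (∧-zeroʳ (toℕ i ≡ᵇ 0))

  nontrivial-rot : ∀ {R S} a → a % n ≢ 0 → hasRot (R , S) a ≡ true → nontrivial (R , S) ≡ true
  nontrivial-rot a a≢0 ha = any-elems⁺ _ (a mod n , false) (∧-true⁺ (rotation≢e a≢0) ha)

  nontrivial-ref : ∀ {R S} a → hasRef (R , S) a ≡ true → nontrivial (R , S) ≡ true
  nontrivial-ref a ha = any-elems⁺ _ (a mod n , true) (∧-true⁺ (reflection≢e (a mod n)) ha)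

  proper-rot : ∀ {R S} a → hasRot (R , S) a ≡ false → proper (R , S) ≡ true
  proper-rot a ha = any-elems⁺ _ (a mod n , false) (cong not ha)

  proper-ref : ∀ {R S} a → hasRef (R , S) a ≡ false → proper (R , S) ≡ true
  proper-ref a ha = any-elems⁺ _ (a mod n , true) (cong not ha)

  cyclic-n-trivial : nontrivial (cyclic n) ≡ false
  cyclic-n-trivial = any≡false⁺ _ elems λ where
      (i , false) → trans (cong (not ((toℕ i ≡ᵇ 0) ∧ true) ∧_)
                             (trans (lookup∘tabulate _ i) (hasResidue-< n (toℕ<n i))))
                           (excluded (toℕ i ≡ᵇ 0))
      (i , true)  → trans (cong (not ((toℕ i ≡ᵇ 0) ∧ false) ∧_) (lookup∘tabulate _ i)) (∧-zeroʳ _)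
    where
    excluded : ∀ z → not (z ∧ true) ∧ z ≡ false
    excluded true  = refl
    excluded false = refl

  dihedral-1-improper : proper (dihedral 1 0) ≡ false
  dihedral-1-improper = any≡false⁺ _ elems λ where
      (i , false) → cong not (trans (lookup∘tabulate _ i) (≡ᵇ-true⁺ (n%1≡0 (toℕ i))))
      (i , true)  → cong not (trans (lookup∘tabulate _ i) (≡ᵇ-true⁺ (n%1≡0 (toℕ i))))

  meets-rot : ∀ {R S R′ S′} a → a % n ≢ 0 → hasRot (R , S) a ≡ true → hasRot (R′ , S′) a ≡ true →
              meets (R , S) (R′ , S′) ≡ true
  meets-rot a a≢0 ha ha′ = any-elems⁺ _ (a mod n , false) (∧-true⁺ (rotation≢e a≢0) (∧-true⁺ ha ha′))

  meets-ref : ∀ {R S R′ S′} a → hasRef (R , S) a ≡ true → hasRef (R′ , S′) a ≡ true → meets (R , S) (R′ , S′) ≡ true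
  meets-ref a ha ha′ = any-elems⁺ _ (a mod n , true) (∧-true⁺ (reflection≢e (a mod n)) (∧-true⁺ ha ha′))

  hasRef-dihedral-n : ∀ {j} → j < n → hasRef (dihedral n j) j ≡ true
  hasRef-dihedral-n j<n = trans (hasRef-dihedral n ∣-refl _ _) (residue-self n j<n)

  -- ⟨r^j s⟩ = {1, r^j s}
  meets-reflection : ∀ {j R S} → j < n → meets (dihedral n j) (R , S) ≡ hasRef (R , S) j
  meets-reflection {j} {R} {S} j<n = ⇔→≡ {z = true} (mk⇔ to (meets-ref j (hasRef-dihedral-n j<n)))
    where
    D = dihedral n j
    common : ∀ x → (not (isE x) ∧ (x ∈ᵇ D) ∧ (x ∈ᵇ (R , S))) ≡ true → hasRef (R , S) j ≡ true
    common (i , false) h = ⊥-elim (excluded (toℕ i ≡ᵇ 0) (lookup R i) (subst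
      (λ b → (not ((toℕ i ≡ᵇ 0) ∧ true) ∧ b ∧ lookup R i) ≡ true) (trans (lookup∘tabulate _ i) (hasResidue-< n (toℕ<n i))) h))
      where
      excluded : ∀ z c → not (z ∧ true) ∧ z ∧ c ≡ true → ⊥
      excluded true  _ ()
      excluded false _ ()
    common (i , true) h with ∧-true⁻ {not ((toℕ i ≡ᵇ 0) ∧ false)} h
    ... | _ , rest with ∧-true⁻ rest
    ... | in-D , in-K = trans (cong (hasRef (R , S)) (sym i≡j)) (trans (hasRef-toℕ (R , S) i) in-K)
      where
      i≡j : toℕ i ≡ j
      i≡j = trans (sym (m<n⇒m%n≡m (toℕ<n i))) (≡ᵇ-true⁻ (trans (sym (lookup∘tabulate _ i)) in-D))
    to : meets D (R , S) ≡ true → hasRef (R , S) j ≡ true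
    to h = let x , hx = any≡true⁻ _ elems h in common x hx

  hasRot-≢ : ∀ {H K} a → hasRot H a ≡ true → hasRot K a ≡ false → H ≢ K
  hasRot-≢ a h k refl with () ← trans (sym h) k

  hasRef-≢ : ∀ {H K} a → hasRef H a ≡ true → hasRef K a ≡ false → H ≢ K
  hasRef-≢ a h k refl with () ← trans (sym h) k

module PrimeSquare (p : ℕ) (p-prime : Prime p) where
  open import Data.Nat using (_+_; _*_)

  instance
    p-nonZero : NonZero p
    p-nonZero = prime⇒nonZero p-prime

  n : ℕ
  n = p * p

  instance
    n-nonZero : NonZero n
    n-nonZero = m*n≢0 p p

  open Dihedral n
  open DihedralGraph n
  open DihedralSubgroups n

  1<p : 1 < p
  1<p = nonTrivial⇒n>1 p {{prime⇒nonTrivial p-prime}}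

  p∣n : p ∣ n
  p∣n = m∣m*n p

  p<n : p < n
  p<n = m<m*n p p 1<p

  coprime-p : ∀ {k} → ¬ p ∣ k → Coprime p k
  coprime-p p∤k (i∣p , i∣k) with prime⇒irreducible p-prime i∣p
  ... | inj₁ i≡1  = i≡1
  ... | inj₂ refl = ⊥-elim (p∤k i∣k)

  coprime-n : ∀ {k} → ¬ p ∣ k → Coprime k n
  coprime-n p∤k (i∣k , i∣n) = coprime-p p∤k (coprime-factors (coprime-p p∤k) (i∣n , ∣m⇒∣m*n p i∣k) , i∣k)

  p-generator : ∀ {k} → k < n → k ≢ 0 → p ∣ k → ∃ λ m → (k * m) % n ≡ p % n
  p-generator {k} k<n k≢0 (divides a k≡a*p) = m , (begin
    (k * m) % n       ≡⟨ cong (λ z → (z * m) % n) k≡a*p ⟩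
    (a * p * m) % n   ≡⟨ cong (_% n) (trans (*-assoc a p m) (trans (cong (a *_) (*-comm p m)) (sym (*-assoc a m p)))) ⟩
    (a * m * p) % n   ≡⟨ m%n*o≡m*o%[n*o] (a * m) p p ⟨
    (a * m) % p * p   ≡⟨ cong (_* p) (trans am≡1 (m<n⇒m%n≡m 1<p)) ⟩
    1 * p             ≡⟨ trans (*-identityˡ p) (sym (m<n⇒m%n≡m p<n)) ⟩
    p % n             ∎)
    where
    open ≡-Reasoning
    a≢0 : a ≢ 0
    a≢0 refl = k≢0 k≡a*p
    a<p : a < p
    a<p = *-cancelʳ-< p a p (subst (_< n) k≡a*p k<n)
    inverse = coprime⇒inverse (Coprime.sym (prime⇒coprime p-prime {{≢-nonZero a≢0}} a<p))
    m = proj₁ inverse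
    am≡1 = proj₂ inverse

  module _ {R S} (H-sub : isSubgroup (R , S) ≡ true) where
    open Closure {R} {S} H-sub

    private
      H : Sub
      H = R , S

    all-rotations : ∀ {k} → hasRot H k ∧ not (hasResidue p 0 k) ≡ true → ∀ t → hasRot H t ≡ hasResidue 1 0 t
    all-rotations {k} hk t = trans (rot-generated t r∈H (cong (_% n) (*-identityˡ t))) (sym (≡ᵇ-true⁺ (n%1≡0 t)))
      where
      p∤k : ¬ p ∣ k
      p∤k p∣k with () ← trans (sym (≡ᵇ-true⁺ (n∣m⇒m%n≡0 k p p∣k))) (not≡true⇒ (proj₂ (∧-true⁻ hk)))
      r∈H : hasRot H 1 ≡ true
      r∈H = let m , km≡1 = coprime⇒inverse (coprime-n p∤k) in rot-generated m (proj₁ (∧-true⁻ hk)) km≡1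

    p-multiples : ∀ {k} → k < n → hasRot H k ∧ not (k ≡ᵇ 0) ≡ true →
                  (∀ j → j < n → hasRot H j ∧ not (hasResidue p 0 j) ≡ false) → ∀ t → hasRot H t ≡ hasResidue p 0 t
    p-multiples {k} k<n hk no-unit = hasRot-ext H (hasResidue p 0) (hasResidue-% p p∣n 0) below
      where
      k∈H = proj₁ (∧-true⁻ hk)
      k≢0 = ≡ᵇ-false⁻ (not≡true⇒ (proj₂ (∧-true⁻ hk)))
      p∣k : p ∣ k
      p∣k with hasResidue p 0 k in eq
      ... | true  = m%n≡0⇒n∣m k p (≡ᵇ-true⁻ eq)
      ... | false with () ← trans (sym k∈H) (∧-not≡false⇒ (no-unit k k<n) eq)
      rp∈H : hasRot H p ≡ true
      rp∈H = let m , km≡p = p-generator k<n k≢0 p∣k in rot-generated m k∈H km≡p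
      below : ∀ j → j < n → hasRot H j ≡ hasResidue p 0 j
      below j j<n with hasResidue p 0 j in eq
      ... | false = ∧-not≡false⇒ (no-unit j j<n) eq
      ... | true with m%n≡0⇒n∣m j p (≡ᵇ-true⁻ eq)
      ...   | divides q j≡q*p = rot-generated q rp∈H (cong (_% n) (trans (*-comm p q) (sym j≡q*p)))

    no-rotations : (∀ j → j < n → hasRot H j ∧ not (j ≡ᵇ 0) ≡ false) → ∀ t → hasRot H t ≡ hasResidue n 0 t
    no-rotations none = hasRot-ext H (hasResidue n 0) (hasResidue-% n ∣-refl 0) below
      where
      below : ∀ j → j < n → hasRot H j ≡ hasResidue n 0 j
      below j j<n with j ≟ 0
      ... | yes refl = trans rot-0 (sym (≡ᵇ-true⁺ (m*n%n≡0 0 n)))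
      ... | no j≢0   = trans (∧-not≡false⇒ (none j j<n) (≡ᵇ-false⁺ j≢0))
                             (sym (trans (hasResidue-< n j<n) (≡ᵇ-false⁺ j≢0)))

    rotations : (∀ k → hasRot H k ≡ hasResidue n 0 k)
              ⊎ (∀ k → hasRot H k ≡ hasResidue p 0 k)
              ⊎ (∀ k → hasRot H k ≡ hasResidue 1 0 k)
    rotations with findBelow (λ k → hasRot H k ∧ not (hasResidue p 0 k)) n
    ... | inj₁ (_ , _ , unit) = inj₂ (inj₂ (all-rotations unit))
    ... | inj₂ no-unit with findBelow (λ k → hasRot H k ∧ not (k ≡ᵇ 0)) n
    ...   | inj₁ (_ , k<n , hk) = inj₂ (inj₁ (p-multiples k<n hk no-unit))
    ...   | inj₂ none           = inj₁ (no-rotations none)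

  -- Subscripts are orders: Cₚ = ⟨r^p⟩, Cₙ = ⟨r⟩, and Dₚ j = ⟨r^p, r^j s⟩ has order 2p.
  Cₚ Cₙ : Sub
  Cₚ = cyclic p
  Cₙ = cyclic 1

  Refl Dₚ : ℕ → Sub
  Refl = dihedral n
  Dₚ   = dihedral p

  Refls Dₚs L : List Sub
  Refls = applyDownFrom Refl n
  Dₚs   = applyDownFrom Dₚ p
  L     = Cₚ ∷ Cₙ ∷ Refls ++ Dₚs

  p∈pℤ : hasResidue p 0 p ≡ true
  p∈pℤ = ≡ᵇ-true⁺ (n%n≡0 p)

  1∉pℤ : hasResidue p 0 1 ≡ false
  1∉pℤ = residue-other p 1<p λ ()

  p∉nℤ : hasResidue n 0 p ≡ false
  p∉nℤ = residue-other n p<n (≢-nonZero⁻¹ p)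

  1∉nℤ : hasResidue n 0 1 ≡ false
  1∉nℤ = residue-other n (<-trans 1<p p<n) λ ()

  p%n≢0 : p % n ≢ 0
  p%n≢0 = subst (_≢ 0) (sym (m<n⇒m%n≡m p<n)) (≢-nonZero⁻¹ p)

  Dₚ-reflection : ∀ {j} → j < p → hasRef (Dₚ j) j ≡ true
  Dₚ-reflection {j} j<p = trans (hasRef-dihedral p p∣n j j) (residue-self p j<p)

  Cₚ-vertex : isVertex Cₚ ≡ true
  Cₚ-vertex = ∧-true⁺ (cyclic-isSubgroup p p∣n) (∧-true⁺
    (nontrivial-rot p p%n≢0 (trans (hasRot-cyclic p p∣n p) p∈pℤ))
    (proper-ref 0 (hasRef-cyclic p p∣n 0)))

  Cₙ-vertex : isVertex Cₙ ≡ true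
  Cₙ-vertex = ∧-true⁺ (cyclic-isSubgroup 1 (1∣ n)) (∧-true⁺
    (nontrivial-rot p p%n≢0 (trans (hasRot-cyclic 1 (1∣ n) p) (≡ᵇ-true⁺ (n%1≡0 p))))
    (proper-ref 0 (hasRef-cyclic 1 (1∣ n) 0)))

  Refl-vertex : ∀ {j} → j < n → isVertex (Refl j) ≡ true
  Refl-vertex {j} j<n = ∧-true⁺ (dihedral-isSubgroup n ∣-refl j) (∧-true⁺
    (nontrivial-ref j (hasRef-dihedral-n j<n))
    (proper-rot 1 (trans (hasRot-dihedral n ∣-refl j 1) 1∉nℤ)))

  Dₚ-vertex : ∀ {j} → j < p → isVertex (Dₚ j) ≡ true
  Dₚ-vertex {j} j<p = ∧-true⁺ (dihedral-isSubgroup p p∣n j) (∧-true⁺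
    (nontrivial-ref j (Dₚ-reflection j<p))
    (proper-rot 1 (trans (hasRot-dihedral p p∣n j 1) 1∉pℤ)))

  Cₚ≢Cₙ : Cₚ ≢ Cₙ
  Cₚ≢Cₙ = hasRot-≢ 1 (trans (hasRot-cyclic 1 (1∣ n) 1) refl) (trans (hasRot-cyclic p p∣n 1) 1∉pℤ) ∘ sym

  cyclic≢Refl : ∀ {d} .{{_ : NonZero d}} → d ∣ n → ∀ {j} → j < n → cyclic d ≢ Refl j
  cyclic≢Refl d∣n j<n = hasRef-≢ _ (hasRef-dihedral-n j<n) (hasRef-cyclic _ d∣n _) ∘ sym

  cyclic≢Dₚ : ∀ {d} .{{_ : NonZero d}} → d ∣ n → ∀ {j} → j < p → cyclic d ≢ Dₚ j
  cyclic≢Dₚ d∣n j<p = hasRef-≢ _ (Dₚ-reflection j<p) (hasRef-cyclic _ d∣n _) ∘ sym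

  Refl≢Dₚ : ∀ {j k} → Refl j ≢ Dₚ k
  Refl≢Dₚ {j} {k} = hasRot-≢ p (trans (hasRot-dihedral p p∣n k p) p∈pℤ) (trans (hasRot-dihedral n ∣-refl j p) p∉nℤ) ∘ sym

  Refl-injective : ∀ {j k} → j < n → j ≢ k → Refl j ≢ Refl k
  Refl-injective j<n j≢k = hasRef-≢ _ (hasRef-dihedral-n j<n) (trans (hasRef-dihedral n ∣-refl _ _) (residue-other n j<n j≢k))

  Dₚ-injective : ∀ {j k} → j < p → j ≢ k → Dₚ j ≢ Dₚ k
  Dₚ-injective j<p j≢k = hasRef-≢ _ (Dₚ-reflection j<p) (trans (hasRef-dihedral p p∣n _ _) (residue-other p j<p j≢k))

  L-unique : Unique L
  L-unique = (Cₚ≢Cₙ All.∷ All-++⁺ (applyDownFrom⁺₁ Refl n (cyclic≢Refl p∣n)) (applyDownFrom⁺₁ Dₚ p (cyclic≢Dₚ p∣n)))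
           ∷ All-++⁺ (applyDownFrom⁺₁ Refl n (cyclic≢Refl (1∣ n))) (applyDownFrom⁺₁ Dₚ p (cyclic≢Dₚ (1∣ n)))
           ∷ Unique.++⁺ (Unique.applyDownFrom⁺₁ Refl n (λ j<i i<n → Refl-injective i<n (>⇒≢ j<i)))
                        (Unique.applyDownFrom⁺₁ Dₚ p (λ j<i i<p → Dₚ-injective i<p (>⇒≢ j<i)))
                        disjoint
    where
    disjoint : ∀ {H} → ¬ (H ∈ Refls × H ∈ Dₚs)
    disjoint (H∈Refls , H∈Dₚs) with ∈-applyDownFrom⁻ Refl H∈Refls | ∈-applyDownFrom⁻ Dₚ H∈Dₚs
    ... | _ , _ , refl | _ , _ , eq = Refl≢Dₚ eq

  Refl∈L : ∀ {j} → j < n → Refl j ∈ L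
  Refl∈L j<n = there (there (∈-++⁺ˡ (∈-applyDownFrom⁺ Refl j<n)))

  Dₚ∈L : ∀ {j} → j < p → Dₚ j ∈ L
  Dₚ∈L j<p = there (there (∈-++⁺ʳ Refls (∈-applyDownFrom⁺ Dₚ j<p)))

  L-vertex : ∀ {H} → H ∈ L → isVertex H ≡ true
  L-vertex (here refl)         = Cₚ-vertex
  L-vertex (there (here refl)) = Cₙ-vertex
  L-vertex (there (there H∈)) with ∈-++⁻ Refls H∈
  ... | inj₁ H∈Refls with ∈-applyDownFrom⁻ Refl H∈Refls
  ...   | _ , j<n , refl = Refl-vertex j<n
  L-vertex (there (there H∈)) | inj₂ H∈Dₚs with ∈-applyDownFrom⁻ Dₚ H∈Dₚs
  ...   | _ , j<p , refl = Dₚ-vertex j<p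

  vertex-∈L : ∀ H → isVertex H ≡ true → H ∈ L
  vertex-∈L (R , S) v with ∧-true⁻ {isSubgroup (R , S)} v
  ... | H-sub , rest with ∧-true⁻ {nontrivial (R , S)} rest
  ... | nontriv , prop with rotations {R} {S} H-sub
  ... | inj₁ nℤ with subgroup-shape {R} {S} H-sub n ∣-refl nℤ
  ...   | inj₁ eq with () ← trans (sym nontriv) (trans (cong nontrivial eq) cyclic-n-trivial)
  ...   | inj₂ (j , j<n , eq) = subst (_∈ L) (sym eq) (Refl∈L j<n)
  vertex-∈L (R , S) v | H-sub , _ | _ , _ | inj₂ (inj₁ pℤ) with subgroup-shape {R} {S} H-sub p p∣n pℤ
  ...   | inj₁ eq             = subst (_∈ L) (sym eq) (here refl)
  ...   | inj₂ (j , j<p , eq) = subst (_∈ L) (sym eq) (Dₚ∈L j<p)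
  vertex-∈L (R , S) v | H-sub , _ | _ , prop | inj₂ (inj₂ ℤ) with subgroup-shape {R} {S} H-sub 1 (1∣ n) ℤ
  ...   | inj₁ eq             = subst (_∈ L) (sym eq) (there (here refl))
  ...   | inj₂ (0 , _ , eq) with () ← trans (sym prop) (trans (cong proper eq) dihedral-1-improper)
  ...   | inj₂ (suc _ , s<s () , _)

  L↭vertices : L ↭ vertices
  L↭vertices = ↭-vertices L L-unique vertex-∈L L-vertex

  p-in-Cₚ : hasRot Cₚ p ≡ true
  p-in-Cₚ = trans (hasRot-cyclic p p∣n p) p∈pℤ

  p-in-Cₙ : hasRot Cₙ p ≡ true
  p-in-Cₙ = trans (hasRot-cyclic 1 (1∣ n) p) (≡ᵇ-true⁺ (n%1≡0 p))

  p-in-Dₚ : ∀ k → hasRot (Dₚ k) p ≡ true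
  p-in-Dₚ k = trans (hasRot-dihedral p p∣n k p) p∈pℤ

  adj-through-rᵖ : ∀ {R S R′ S′} → (R , S) ≢ (R′ , S′) → hasRot (R , S) p ≡ true → hasRot (R′ , S′) p ≡ true →
                   adj (R , S) (R′ , S′) ≡ true
  adj-through-rᵖ H≢K hp kp = trans (adj≡meets _ _ H≢K) (meets-rot p p%n≢0 hp kp)

  adj-Cₚ-Cₙ : adj Cₚ Cₙ ≡ true
  adj-Cₚ-Cₙ = adj-through-rᵖ Cₚ≢Cₙ p-in-Cₚ p-in-Cₙ

  adj-Cₚ-Dₚ : ∀ {k} → k < p → adj Cₚ (Dₚ k) ≡ true
  adj-Cₚ-Dₚ {k} k<p = adj-through-rᵖ (cyclic≢Dₚ p∣n k<p) p-in-Cₚ (p-in-Dₚ k)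

  adj-Cₙ-Dₚ : ∀ {k} → k < p → adj Cₙ (Dₚ k) ≡ true
  adj-Cₙ-Dₚ {k} k<p = adj-through-rᵖ (cyclic≢Dₚ (1∣ n) k<p) p-in-Cₙ (p-in-Dₚ k)

  adj-Dₚ-Dₚ : ∀ {j k} → j < p → adj (Dₚ j) (Dₚ k) ≡ not (j ≡ᵇ k)
  adj-Dₚ-Dₚ {j} {k} j<p with j ≟ k
  ... | yes refl = trans (adj-irrefl (Dₚ j)) (cong not (sym (≡ᵇ-true⁺ (refl {x = j}))))
  ... | no j≢k   = trans (adj-through-rᵖ (Dₚ-injective j<p j≢k) (p-in-Dₚ j) (p-in-Dₚ k)) (cong not (sym (≡ᵇ-false⁺ j≢k)))

  adj-Refl : ∀ {j R S} → j < n → Refl j ≢ (R , S) → adj (Refl j) (R , S) ≡ hasRef (R , S) j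
  adj-Refl j<n ne = trans (adj≡meets _ _ ne) (meets-reflection j<n)

  adj-Refl-Cₚ : ∀ {j} → j < n → adj (Refl j) Cₚ ≡ false
  adj-Refl-Cₚ j<n = trans (adj-Refl j<n (cyclic≢Refl p∣n j<n ∘ sym)) (hasRef-cyclic p p∣n _)

  adj-Refl-Cₙ : ∀ {j} → j < n → adj (Refl j) Cₙ ≡ false
  adj-Refl-Cₙ j<n = trans (adj-Refl j<n (cyclic≢Refl (1∣ n) j<n ∘ sym)) (hasRef-cyclic 1 (1∣ n) _)

  adj-Refl-Refl : ∀ {j k} → j < n → adj (Refl j) (Refl k) ≡ false
  adj-Refl-Refl {j} {k} j<n with j ≟ k
  ... | yes refl = adj-irrefl (Refl j)
  ... | no j≢k   = trans (adj-Refl j<n (Refl-injective j<n j≢k))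
                         (trans (hasRef-dihedral n ∣-refl k j) (residue-other n j<n j≢k))

  adj-Refl-Dₚ : ∀ {j k} → j < n → adj (Refl j) (Dₚ k) ≡ hasResidue p k j
  adj-Refl-Dₚ {j} {k} j<n = trans (adj-Refl j<n Refl≢Dₚ) (hasRef-dihedral p p∣n k j)

  sumBy-Refls++Dₚs : ∀ g → sumBy g (Refls ++ Dₚs) ≡ sumBelow (g ∘ Refl) n + sumBelow (g ∘ Dₚ) p
  sumBy-Refls++Dₚs g =
    trans (sumBy-++ g Refls Dₚs) (cong₂ _+_ (sumBy-applyDownFrom g Refl n) (sumBy-applyDownFrom g Dₚ p))

  sumBy-L : ∀ g → sumBy g L ≡ g Cₚ + (g Cₙ + (sumBelow (g ∘ Refl) n + sumBelow (g ∘ Dₚ) p))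
  sumBy-L g = cong (λ z → g Cₚ + (g Cₙ + z)) (sumBy-Refls++Dₚs g)

  degree : ∀ u {a b c d} → indicator (adj u Cₚ) ≡ a → indicator (adj u Cₙ) ≡ b →
           sumBelow (indicator ∘ adj u ∘ Refl) n ≡ c → sumBelow (indicator ∘ adj u ∘ Dₚ) p ≡ d →
           deg u ≡ a + (b + (c + d))
  degree u ha hb hc hd = trans (deg-↭ L↭vertices u)
    (trans (sumBy-L (indicator ∘ adj u)) (cong₂ _+_ ha (cong₂ _+_ hb (cong₂ _+_ hc hd))))

  dC dD : ℕ
  dC = suc p
  dD = 2 * p + 1

  deg-Cₚ : deg Cₚ ≡ dC
  deg-Cₚ = trans (degree Cₚ (cong indicator (adj-irrefl Cₚ)) (cong indicator adj-Cₚ-Cₙ)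
                   (sumBelow-zero n λ j j<n → cong indicator (trans (adj-sym Cₚ (Refl j)) (adj-Refl-Cₚ j<n)))
                   (sumBelow-const p 1 λ k k<p → cong indicator (adj-Cₚ-Dₚ k<p)))
                 (cong suc (*-identityʳ p))

  deg-Cₙ : deg Cₙ ≡ dC
  deg-Cₙ = trans (degree Cₙ (cong indicator (trans (adj-sym Cₙ Cₚ) adj-Cₚ-Cₙ)) (cong indicator (adj-irrefl Cₙ))
                   (sumBelow-zero n λ j j<n → cong indicator (trans (adj-sym Cₙ (Refl j)) (adj-Refl-Cₙ j<n)))
                   (sumBelow-const p 1 λ k k<p → cong indicator (adj-Cₙ-Dₚ k<p)))
                 (cong suc (*-identityʳ p))

  deg-Refl : ∀ {j} → j < n → deg (Refl j) ≡ 1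
  deg-Refl {j} j<n = degree (Refl j) (cong indicator (adj-Refl-Cₚ j<n)) (cong indicator (adj-Refl-Cₙ j<n))
    (sumBelow-zero n λ k _ → cong indicator (adj-Refl-Refl j<n))
    (trans (sumBelow-cong p λ k _ → cong indicator (adj-Refl-Dₚ j<n)) (sumBelow-indicator (j % p) 1 p (m%n<n j p)))

  deg-Dₚ : ∀ {j} → j < p → deg (Dₚ j) ≡ dD
  deg-Dₚ {j} j<p = trans (degree (Dₚ j)
      (cong indicator (trans (adj-sym (Dₚ j) Cₚ) (adj-Cₚ-Dₚ j<p)))
      (cong indicator (trans (adj-sym (Dₚ j) Cₙ) (adj-Cₙ-Dₚ j<p)))
      (trans (sumBelow-cong n λ i i<n → cong indicator (trans (adj-sym (Dₚ j) (Refl i)) (adj-Refl-Dₚ i<n)))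
             (sumBelow-residue p j 1 j<p p))
      (sumBelow-cong p λ k _ → cong indicator (adj-Dₚ-Dₚ j<p)))
    (count (sumBelow-coindicator j p j<p))
    where
    count : ∀ {c} → c + 1 ≡ p → 1 + (1 + (p * 1 + c)) ≡ dD
    count {c} c+1≡p = begin
      1 + (1 + (p * 1 + c)) ≡⟨ solve (p ∷ c ∷ []) ⟩
      p + (c + 1) + 1       ≡⟨ cong (λ z → p + z + 1) c+1≡p ⟩
      p + p + 1             ≡⟨ cong (_+ 1) (cong (p +_) (sym (+-identityʳ p))) ⟩
      dD                    ∎
      where open ≡-Reasoning

  weights-Cₚ : sumBy (weight Cₚ) (Cₙ ∷ Refls ++ Dₚs) ≡ dC * dC + (0 + p * (dC * dD))
  weights-Cₚ = cong₂ _+_ (trans (weight-adj adj-Cₚ-Cₙ) (cong₂ _*_ deg-Cₚ deg-Cₙ))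
    (trans (sumBy-Refls++Dₚs (weight Cₚ)) (cong₂ _+_
      (sumBelow-zero n λ j j<n → weight-nonadj (trans (adj-sym Cₚ (Refl j)) (adj-Refl-Cₚ j<n)))
      (sumBelow-const p (dC * dD) λ k k<p → trans (weight-adj (adj-Cₚ-Dₚ k<p)) (cong₂ _*_ deg-Cₚ (deg-Dₚ k<p)))))

  weights-Cₙ : sumBy (weight Cₙ) (Refls ++ Dₚs) ≡ 0 + p * (dC * dD)
  weights-Cₙ = trans (sumBy-Refls++Dₚs (weight Cₙ)) (cong₂ _+_
    (sumBelow-zero n λ j j<n → weight-nonadj (trans (adj-sym Cₙ (Refl j)) (adj-Refl-Cₙ j<n)))
    (sumBelow-const p (dC * dD) λ k k<p → trans (weight-adj (adj-Cₙ-Dₚ k<p)) (cong₂ _*_ deg-Cₙ (deg-Dₚ k<p))))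

  edgeSum-Refls : edgeSum Refls ≡ 0
  edgeSum-Refls = trans (edgeSum-applyDownFrom Refl n) (sumBelow-zero n λ j j<n →
    sumBelow-zero j λ k _ → weight-nonadj (adj-Refl-Refl j<n))

  edgeSum-Dₚs : edgeSum Dₚs ≡ sumBelow id p * (dD * dD)
  edgeSum-Dₚs = trans (edgeSum-applyDownFrom Dₚ p)
    (trans (sumBelow-cong p (λ j j<p → sumBelow-const j (dD * dD) λ k k<j → edge j<p k<j)) (sumBelow-*ʳ (dD * dD) p))
    where
    edge : ∀ {j k} → j < p → k < j → weight (Dₚ j) (Dₚ k) ≡ dD * dD
    edge {j} {k} j<p k<j = trans (weight-adj (trans (adj-Dₚ-Dₚ j<p) (cong not (≡ᵇ-false⁺ (>⇒≢ k<j)))))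
                                 (cong₂ _*_ (deg-Dₚ j<p) (deg-Dₚ (<-trans k<j j<p)))

  cross-Refls-Dₚs : cross Refls Dₚs ≡ n * (1 * dD)
  cross-Refls-Dₚs = trans (sumBy-applyDownFrom _ Refl n) (sumBelow-const n (1 * dD) λ j j<n →
    trans (sumBy-applyDownFrom _ Dₚ p)
      (trans (sumBelow-cong p (λ k k<p → edge j<n k<p)) (sumBelow-indicator (j % p) (1 * dD) p (m%n<n j p))))
    where
    edge : ∀ {j k} → j < n → k < p → weight (Refl j) (Dₚ k) ≡ (if j % p ≡ᵇ k then 1 * dD else 0)
    edge {j} {k} j<n k<p with j % p ≡ᵇ k in eq
    ... | true  = trans (weight-adj (trans (adj-Refl-Dₚ j<n) eq)) (cong₂ _*_ (deg-Refl j<n) (deg-Dₚ k<p))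
    ... | false = weight-nonadj (trans (adj-Refl-Dₚ j<n) eq)

  M₂-value : M₂ ≡ dC * dC + 2 * (p * (dC * dD)) + sumBelow id p * (dD * dD) + n * dD
  M₂-value = begin
    edgeSum vertices
      ≡⟨ edgeSum-↭ L↭vertices ⟨
    edgeSum L
      ≡⟨ trans (edgeSum-∷ Cₚ (Cₙ ∷ Refls ++ Dₚs)) (cong (sumBy (weight Cₚ) (Cₙ ∷ Refls ++ Dₚs) +_) (edgeSum-∷ Cₙ (Refls ++ Dₚs))) ⟩
    sumBy (weight Cₚ) (Cₙ ∷ Refls ++ Dₚs) + (sumBy (weight Cₙ) (Refls ++ Dₚs) + edgeSum (Refls ++ Dₚs))
      ≡⟨ cong₂ _+_ weights-Cₚ (cong₂ _+_ weights-Cₙ (edgeSum-++ Refls Dₚs)) ⟩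
    dC * dC + (0 + p * (dC * dD)) + (0 + p * (dC * dD) + (edgeSum Refls + edgeSum Dₚs + cross Refls Dₚs))
      ≡⟨ cong (λ z → dC * dC + (0 + p * (dC * dD)) + (0 + p * (dC * dD) + z))
           (cong₂ _+_ (cong₂ _+_ edgeSum-Refls edgeSum-Dₚs) cross-Refls-Dₚs) ⟩
    dC * dC + (0 + p * (dC * dD)) + (0 + p * (dC * dD) + (0 + Σj * (dD * dD) + n * (1 * dD)))
      ≡⟨ collect (dC * dC) (p * (dC * dD)) Σj (dD * dD) n dD ⟩
    dC * dC + 2 * (p * (dC * dD)) + Σj * (dD * dD) + n * dD ∎
    where
    open ≡-Reasoning
    Σj = sumBelow id p
    collect : ∀ c e t D m d → c + (0 + e) + (0 + e + (0 + t * D + m * (1 * d))) ≡ c + 2 * e + t * D + m * d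
    collect = solve-∀

  twice-M₂ : 2 * M₂ ≡ (((4 * p + 12) * p + 13) * p + 7) * p + 2
  twice-M₂ = trans (cong (2 *_) M₂-value) (zagreb-polynomial p (sumBelow id p) (2*sumBelow-id+m≡m*m p))

M₂D-nonZero : ∀ n .{{_ : NonZero n}} → M₂D n ≡ Dihedral.M₂ n
M₂D-nonZero (suc k) = refl

open import Data.Integer as ℤ using (+_)
import Data.Integer.Properties as ℤ
open import Data.Rational using (ℚ; _/_; _+_; _*_; toℚᵘ)
open import Data.Rational.Properties using (toℚᵘ-injective; toℚᵘ-fromℚᵘ; toℚᵘ-homo-+; toℚᵘ-homo-*)
open import Data.Rational.Solver using (module +-*-Solver)
open import Data.Rational.Unnormalised as ℚᵘ using (mkℚᵘ; _≃_)
import Data.Rational.Unnormalised.Properties as ℚᵘ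

toℚ : ℕ → ℚ
toℚ k = + k / 1

toℚᵘ-toℚ : ∀ k → toℚᵘ (toℚ k) ≃ mkℚᵘ (+ k) 0
toℚᵘ-toℚ k = toℚᵘ-fromℚᵘ (mkℚᵘ (+ k) 0)

toℚ-+ : ∀ a b → toℚ (a ℕ.+ b) ≡ toℚ a + toℚ b
toℚ-+ a b = toℚᵘ-injective (begin
  toℚᵘ (toℚ (a ℕ.+ b))             ≈⟨ toℚᵘ-toℚ (a ℕ.+ b) ⟩
  mkℚᵘ (+ (a ℕ.+ b)) 0             ≡⟨ cong (λ z → mkℚᵘ z 0) (trans (ℤ.pos-+ a b)
                                         (sym (cong₂ ℤ._+_ (ℤ.*-identityʳ (+ a)) (ℤ.*-identityʳ (+ b))))) ⟩
  mkℚᵘ (+ a) 0 ℚᵘ.+ mkℚᵘ (+ b) 0   ≈⟨ ℚᵘ.+-cong (toℚᵘ-toℚ a) (toℚᵘ-toℚ b) ⟨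
  toℚᵘ (toℚ a) ℚᵘ.+ toℚᵘ (toℚ b)   ≈⟨ toℚᵘ-homo-+ (toℚ a) (toℚ b) ⟨
  toℚᵘ (toℚ a + toℚ b)             ∎)
  where open ℚᵘ.≃-Reasoning

toℚ-* : ∀ a b → toℚ (a ℕ.* b) ≡ toℚ a * toℚ b
toℚ-* a b = toℚᵘ-injective (begin
  toℚᵘ (toℚ (a ℕ.* b))             ≈⟨ toℚᵘ-toℚ (a ℕ.* b) ⟩
  mkℚᵘ (+ (a ℕ.* b)) 0             ≡⟨ cong (λ z → mkℚᵘ z 0) (ℤ.pos-* a b) ⟩
  mkℚᵘ (+ a) 0 ℚᵘ.* mkℚᵘ (+ b) 0   ≈⟨ ℚᵘ.*-cong (toℚᵘ-toℚ a) (toℚᵘ-toℚ b) ⟨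
  toℚᵘ (toℚ a) ℚᵘ.* toℚᵘ (toℚ b)   ≈⟨ toℚᵘ-homo-* (toℚ a) (toℚ b) ⟨
  toℚᵘ (toℚ a * toℚ b)             ∎)
  where open ℚᵘ.≃-Reasoning

toℚ-*+ : ∀ a b c → toℚ (a ℕ.* b ℕ.+ c) ≡ toℚ a * toℚ b + toℚ c
toℚ-*+ a b c = trans (toℚ-+ (a ℕ.* b) c) (cong (_+ toℚ c) (toℚ-* a b))

toℚ-horner : ∀ p → toℚ ((((4 ℕ.* p ℕ.+ 12) ℕ.* p ℕ.+ 13) ℕ.* p ℕ.+ 7) ℕ.* p ℕ.+ 2)
                 ≡ (((toℚ 4 * toℚ p + toℚ 12) * toℚ p + toℚ 13) * toℚ p + toℚ 7) * toℚ p + toℚ 2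
toℚ-horner p = begin
  toℚ (h₃ ℕ.* p ℕ.+ 2)                             ≡⟨ toℚ-*+ h₃ p 2 ⟩
  toℚ h₃ * x + toℚ 2                               ≡⟨ cong (λ z → z * x + toℚ 2) (toℚ-*+ h₂ p 7) ⟩
  (toℚ h₂ * x + toℚ 7) * x + toℚ 2                 ≡⟨ cong (λ z → (z * x + toℚ 7) * x + toℚ 2) (toℚ-*+ h₁ p 13) ⟩
  ((toℚ h₁ * x + toℚ 13) * x + toℚ 7) * x + toℚ 2  ≡⟨ cong (λ z → ((z * x + toℚ 13) * x + toℚ 7) * x + toℚ 2)
                                                          (toℚ-*+ 4 p 12) ⟩
  (((toℚ 4 * x + toℚ 12) * x + toℚ 13) * x + toℚ 7) * x + toℚ 2 ∎
  where
  open ≡-Reasoning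
  x = toℚ p
  h₁ = 4 ℕ.* p ℕ.+ 12
  h₂ = h₁ ℕ.* p ℕ.+ 13
  h₃ = h₂ ℕ.* p ℕ.+ 7

module _ where
  open +-*-Solver renaming (solve to solveℚ)

  halve : ∀ q → q ≡ (+ 1 / 2) * (toℚ 2 * q)
  halve = solveℚ 1 (λ q → q := con (+ 1 / 2) :* (con (toℚ 2) :* q)) refl

  half-horner : ∀ x → (+ 1 / 2) * ((((toℚ 4 * x + toℚ 12) * x + toℚ 13) * x + toℚ 7) * x + toℚ 2)
                    ≡ (+ 2 / 1) * (x * x * x * x) + (+ 6 / 1) * (x * x * x) + (+ 13 / 2) * (x * x) + (+ 7 / 2) * x + (+ 1 / 1)
  half-horner = solveℚ 1 (λ x →
      con (+ 1 / 2) :* ((((con (toℚ 4) :* x :+ con (toℚ 12)) :* x :+ con (toℚ 13)) :* x :+ con (toℚ 7)) :* x :+ con (toℚ 2))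
    := con (+ 2 / 1) :* (x :* x :* x :* x) :+ con (+ 6 / 1) :* (x :* x :* x) :+ con (+ 13 / 2) :* (x :* x)
       :+ con (+ 7 / 2) :* x :+ con (+ 1 / 1)) refl

theorem3p4 : (p : ℕ) → Prime p →
    (+ M₂D (p ^ 2)) / 1
    ≡ (+ 2 / 1) * ((+ p / 1) * (+ p / 1) * (+ p / 1) * (+ p / 1))
    + (+ 6 / 1) * ((+ p / 1) * (+ p / 1) * (+ p / 1))
    + (+ 13 / 2) * ((+ p / 1) * (+ p / 1))
    + (+ 7 / 2) * (+ p / 1)
    + (+ 1 / 1)
theorem3p4 p p-prime = begin
  toℚ (M₂D (p ^ 2))            ≡⟨ cong toℚ (trans (cong (M₂D ∘ (p ℕ.*_)) (*-identityʳ p)) (M₂D-nonZero n)) ⟩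
  toℚ M₂                       ≡⟨ halve (toℚ M₂) ⟩
  (+ 1 / 2) * (toℚ 2 * toℚ M₂) ≡⟨ cong ((+ 1 / 2) *_) (toℚ-* 2 M₂) ⟨
  (+ 1 / 2) * toℚ (2 ℕ.* M₂)   ≡⟨ cong ((+ 1 / 2) *_) (trans (cong toℚ twice-M₂) (toℚ-horner p)) ⟩
  (+ 1 / 2) * ((((toℚ 4 * toℚ p + toℚ 12) * toℚ p + toℚ 13) * toℚ p + toℚ 7) * toℚ p + toℚ 2)
                               ≡⟨ half-horner (toℚ p) ⟩
  _                            ∎
  where
  open ≡-Reasoning
  open PrimeSquare p p-prime using (n; n-nonZero; twice-M₂)
  M₂ = Dihedral.M₂ n
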